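{- For every $u\in A^*$, \[\sum_{v\in N(u,A)}\mathrm{contr}(u,v)-2\,\mathrm{charge}(u,n(u))\geq 2\xi\cdot w(\mathrm{supp}(u)).\]
   Context: Let $k\geq 4$ be an integer and $G=(V,E)$ a finite simple $(k+1)$-claw free graph (no vertex has $k+1$ pairwise non-adjacent neighbors) with weights $w:V\to\mathbb{Q}_{>0}$; $w(X)=\sum_{x\in X}w(x)$, $w^2(X)=\sum_{x\in X}w(x)^2$. Let $A^*$ be a maximum-weight independent set and $A$ an independent set. $N(X,A)=(X\cap A)\cup\{a\in A: a\text{ adjacent to some }x\in X\}$, $N(u,A)=N(\{u\},A)$. An independent $X$ is a local improvement if $w^2(X)>w^2(N(X,A))$; it is claw-shaped if $|X|=1$ and $N(X,A)=\emptyset$, or some $v\in A$ is adjacent to all of $X$. Assume no claw-shaped improvement of $A$ exists (so $A$ is maximal). Fix $n(u)\in N(u,A)$ of maximum weight and, if $|N(u,A)|\geq2$, $n_2(u)\in N(u,A)\setminus\{n(u)\}$ of maximum weight. $\mathrm{contr}(u,v)=\max\{0,(w(u)^2-w^2(N(u,A)\setminus\{v\}))/w(v)\}$ if $v\in N(u,A)$, else $0$; $\mathrm{charge}(u,v)=w(u)-\frac12w(N(u,A))$ if $v=n(u)$, else $0$. Constants $\epsilon,\xi>0$ satisfy: $\frac38(1+\epsilon)^2+\epsilon^2\leq\frac{11}{16}(1+\epsilon)^2+\epsilon^2\leq\frac34(1+\epsilon)^2+\epsilon^2\leq1$; $\frac{1-\epsilon}{2}\geq\frac{1-\epsilon(1+\epsilon)}{2}\geq\frac{1-2\epsilon(1+\epsilon)}{2}\geq\xi$;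 $\big(1-\sqrt{\tfrac{5}{8(1-\epsilon^2)}}\big)^2/\big(1+\epsilon\sqrt{\tfrac{5}{8(1-\epsilon^2)}}\big)\geq 2\xi$; $\min\{\frac{\epsilon}{2+\epsilon},\frac14,\frac1{4(1+\epsilon)},\frac{\epsilon}{2(1+\epsilon)},\frac{\epsilon}{4+2\epsilon}\}\geq\frac{\epsilon}{4(2+\epsilon)}\geq\xi$; $\frac{\epsilon}{2(1+\epsilon)(2+\epsilon)}\geq\frac{\epsilon}{2(1+\epsilon)^2(2+\epsilon)}\geq\frac{\epsilon}{2(1+\epsilon)^3(2+\epsilon)}\geq\xi$; $\frac{(1/3-\epsilon)^2}{(4/3+2\epsilon)(2+\epsilon)}\geq\xi$; $\epsilon\big(\frac{2+(1+\epsilon)^{ -1}}{2+\epsilon}-(1+\epsilon)\big)\geq2\xi$. Helpful: $u\in N(v,V\setminus A)$ is helpful for $v\in A$ if either (a) $v=n(u)$, $w(n(u))\leq(1+\epsilon)w(u)$ and $w(N(u,A)\setminus\{n(u)\})\leq\epsilon w(u)$; or (b) $|N(u,A)|\geq2$, $v\in\{n(u),n_2(u)\}$, $(1+\epsilon)^{ -1}w(n(u))\leq w(n_2(u))\leq w(n(u))\leq(1+\epsilon)w(u)$ and $w(N(u,A)\setminus\{n(u),n_2(u)\})\leq\epsilon w(u)$. $\mathrm{help}(u)$ is the set of $v\in A$ that $u$ is helpful for. $u\in A^*$ and $v\in A$ are special neighbors if $v=n(u)$, $v\notin\mathrm{help}(u)$ and $\mathrm{contr}(u,v)>\frac58w(v)$.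 For $u\in A^*$, $\mathrm{supp}(u)=\{v\in N(u,A)\setminus\mathrm{help}(u): u\text{ and }v\text{ are not special neighbors}\}$. -}

module Defs where

open import Data.Nat as ℕ using (ℕ; zero; suc)
open import Data.Integer using (+_)
open import Data.Fin as Fin using (Fin)
open import Data.Fin.Subset using (Subset; _∈_; ∣_∣; ⁅_⁆; ∁; _∩_; Empty)
open import Data.Vec using (lookup; tabulate)
open import Data.Bool using (Bool; true; false; _∧_; _∨_; not; if_then_else_)
open import Data.Product using (Σ; _×_; _,_)
open import Data.Sum using (_⊎_)
open import Data.Rational using (ℚ; 0ℚ; 1ℚ; ½; _+_; _*_; _-_; _÷_; _⊔_; _≤_; _<_; ≢-nonZero)
open import Data.Rational.Properties using (_≟_; _≤?_; _<?_)
open import Relation.Nullary using (¬_; yes; no)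
open import Relation.Nullary.Decidable using (⌊_⌋)
open import Relation.Binary.PropositionalEquality using (_≡_; _≢_)

record Graph (n : ℕ) : Set where
  field
    adj    : Fin n → Fin n → Bool
    sym    : ∀ x y → adj x y ≡ adj y x
    irrefl : ∀ x → adj x x ≡ false

-- total division; only ever used with positive denominators
infixl 7 _/'_
_/'_ : ℚ → ℚ → ℚ
p /' q with q ≟ 0ℚ
... | yes _  = 0ℚ
... | no q≢0 = _÷_ p q {{≢-nonZero q≢0}}

infix 30 _//_
_//_ : ℕ → (b : ℕ) → .{{_ : ℕ.NonZero b}} → ℚ
a // b = Data.Rational._/_ (+ a) b

sq : ℚ → ℚ
sq p = p * p

Σᵛ : ∀ {n} → (Fin n → ℚ) → ℚ
Σᵛ {zero}  f = 0ℚ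
Σᵛ {suc n} f = f Fin.zero + Σᵛ (λ i → f (Fin.suc i))

anyᵛ : ∀ {n} → (Fin n → Bool) → Bool
anyᵛ {zero}  f = false
anyᵛ {suc n} f = f Fin.zero ∨ anyᵛ (λ i → f (Fin.suc i))

wt : ∀ {n} → (Fin n → ℚ) → Subset n → ℚ
wt w X = Σᵛ (λ i → if lookup X i then w i else 0ℚ)

wt² : ∀ {n} → (Fin n → ℚ) → Subset n → ℚ
wt² w X = Σᵛ (λ i → if lookup X i then sq (w i) else 0ℚ)

module _ {n : ℕ} (G : Graph n) where
  open Graph G

  Independent : Subset n → Set
  Independent X = ∀ x y → x ∈ X → y ∈ X → adj x y ≡ false

  -- N(X,A) = (X ∩ A) ∪ {a ∈ A : a adjacent to some x ∈ X}
  Nb : Subset n → Subset n → Subset n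
  Nb X A = tabulate λ a → lookup A a ∧ (lookup X a ∨ anyᵛ (λ x → lookup X x ∧ adj a x))

  ClawFree : ℕ → Set
  ClawFree k = ∀ v (S : Subset n) → ∣ S ∣ ≡ suc k →
               (∀ x → x ∈ S → adj v x ≡ true) → ¬ Independent S

  MaxWeightIndep : (Fin n → ℚ) → Subset n → Set
  MaxWeightIndep w A* = Independent A* × (∀ X → Independent X → wt w X ≤ wt w A*)

  LocalImprovement : (Fin n → ℚ) → Subset n → Subset n → Set
  LocalImprovement w A X = Independent X × (wt² w (Nb X A) < wt² w X)

  ClawShaped : Subset n → Subset n → Set
  ClawShaped A X = (∣ X ∣ ≡ 1 × Empty (Nb X A))
                 ⊎ Σ (Fin n) (λ v → v ∈ A × (∀ x → x ∈ X → adj v x ≡ true))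

  NoClawShapedImprovement : (Fin n → ℚ) → Subset n → Set
  NoClawShapedImprovement w A = ∀ X → ClawShaped A X → ¬ LocalImprovement w A X

  IsChoiceN : (Fin n → ℚ) → Subset n → (Fin n → Fin n) → Set
  IsChoiceN w A nA = ∀ u → ¬ Empty (Nb ⁅ u ⁆ A) →
      nA u ∈ Nb ⁅ u ⁆ A × (∀ a → a ∈ Nb ⁅ u ⁆ A → w a ≤ w (nA u))

  IsChoiceN₂ : (Fin n → ℚ) → Subset n → (Fin n → Fin n) → (Fin n → Fin n) → Set
  IsChoiceN₂ w A nA n2A = ∀ u → 2 ℕ.≤ ∣ Nb ⁅ u ⁆ A ∣ →
      n2A u ∈ Nb ⁅ u ⁆ A × n2A u ≢ nA u ×
      (∀ a → a ∈ Nb ⁅ u ⁆ A → a ≢ nA u → w a ≤ w (n2A u))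

Constants : ℚ → ℚ → Set
Constants ε ξ =
  (0ℚ < ε) × (0ℚ < ξ) ×
  ((3 // 8) * sq (1ℚ + ε) + sq ε ≤ (11 // 16) * sq (1ℚ + ε) + sq ε) ×
  ((11 // 16) * sq (1ℚ + ε) + sq ε ≤ (3 // 4) * sq (1ℚ + ε) + sq ε) ×
  ((3 // 4) * sq (1ℚ + ε) + sq ε ≤ 1ℚ) ×
  ((1ℚ - ε * (1ℚ + ε)) * ½ ≤ (1ℚ - ε) * ½) ×
  ((1ℚ - 2 // 1 * ε * (1ℚ + ε)) * ½ ≤ (1ℚ - ε * (1ℚ + ε)) * ½) ×
  (ξ ≤ (1ℚ - 2 // 1 * ε * (1ℚ + ε)) * ½) ×
  -- (1 - √c)² / (1 + ε√c) ≥ 2ξ  with  c = 5/(8(1-ε²));  stated without √ as: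
  -- every rational s ≥ 0 with (1-s)²/(1+εs) < 2ξ satisfies c ≤ s²
  (∀ (s : ℚ) → 0ℚ ≤ s → sq (1ℚ - s) /' (1ℚ + ε * s) < 2 // 1 * ξ →
       5 // 1 /' (8 // 1 * (1ℚ - sq ε)) ≤ sq s) ×
  (ε /' (4 // 1 * (2 // 1 + ε)) ≤ ε /' (2 // 1 + ε)) ×
  (ε /' (4 // 1 * (2 // 1 + ε)) ≤ 1 // 4) ×
  (ε /' (4 // 1 * (2 // 1 + ε)) ≤ 1ℚ /' (4 // 1 * (1ℚ + ε))) ×
  (ε /' (4 // 1 * (2 // 1 + ε)) ≤ ε /' (2 // 1 * (1ℚ + ε))) ×
  (ε /' (4 // 1 * (2 // 1 + ε)) ≤ ε /' (4 // 1 + 2 // 1 * ε)) ×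
  (ξ ≤ ε /' (4 // 1 * (2 // 1 + ε))) ×
  (ε /' (2 // 1 * sq (1ℚ + ε) * (2 // 1 + ε)) ≤ ε /' (2 // 1 * (1ℚ + ε) * (2 // 1 + ε))) ×
  (ε /' (2 // 1 * (sq (1ℚ + ε) * (1ℚ + ε)) * (2 // 1 + ε))
       ≤ ε /' (2 // 1 * sq (1ℚ + ε) * (2 // 1 + ε))) ×
  (ξ ≤ ε /' (2 // 1 * (sq (1ℚ + ε) * (1ℚ + ε)) * (2 // 1 + ε))) ×
  (ξ ≤ sq (1 // 3 - ε) /' ((4 // 3 + 2 // 1 * ε) * (2 // 1 + ε))) ×
  (2 // 1 * ξ ≤ ε * ((2 // 1 + 1ℚ /' (1ℚ + ε)) /' (2 // 1 + ε) - (1ℚ + ε)))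

module Setup {n : ℕ} (G : Graph n) (w : Fin n → ℚ) (A A* : Subset n)
             (nA n2A : Fin n → Fin n) (ε : ℚ) where
  open Graph G

  NA : Fin n → Subset n
  NA u = Nb G ⁅ u ⁆ A

  _∖ʳ_ : Subset n → Fin n → Subset n
  X ∖ʳ v = X ∩ ∁ ⁅ v ⁆

  ⌊∈⌋ : Fin n → Subset n → Bool
  ⌊∈⌋ v X = lookup X v

  ⌊≡⌋ : Fin n → Fin n → Bool
  ⌊≡⌋ x y = ⌊ x Fin.≟ y ⌋

  ⌊≤⌋ : ℚ → ℚ → Bool
  ⌊≤⌋ p q = ⌊ p ≤? q ⌋

  contr : Fin n → Fin n → ℚ
  contr u v = if ⌊∈⌋ v (NA u)
              then 0ℚ ⊔ ((sq (w u) - wt² w (NA u ∖ʳ v)) /' w v)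
              else 0ℚ

  charge : Fin n → Fin n → ℚ
  charge u v = if ⌊≡⌋ v (nA u) then w u - ½ * wt w (NA u) else 0ℚ

  helpfulA : Fin n → Fin n → Bool
  helpfulA u v = ⌊≡⌋ v (nA u)
               ∧ ⌊≤⌋ (w (nA u)) ((1ℚ + ε) * w u)
               ∧ ⌊≤⌋ (wt w (NA u ∖ʳ nA u)) (ε * w u)

  helpfulB : Fin n → Fin n → Bool
  helpfulB u v = ⌊ 2 ℕ.≤? ∣ NA u ∣ ⌋
               ∧ (⌊≡⌋ v (nA u) ∨ ⌊≡⌋ v (n2A u))
               ∧ ⌊≤⌋ ((1ℚ /' (1ℚ + ε)) * w (nA u)) (w (n2A u))
               ∧ ⌊≤⌋ (w (n2A u)) (w (nA u))
               ∧ ⌊≤⌋ (w (nA u)) ((1ℚ + ε) * w u)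
               ∧ ⌊≤⌋ (wt w ((NA u ∖ʳ nA u) ∖ʳ n2A u)) (ε * w u)

  helpful : Fin n → Fin n → Bool
  helpful u v = ⌊∈⌋ u (Nb G ⁅ v ⁆ (∁ A)) ∧ (helpfulA u v ∨ helpfulB u v)

  help : Fin n → Subset n
  help u = tabulate λ v → ⌊∈⌋ v A ∧ helpful u v

  special : Fin n → Fin n → Bool
  special u v = ⌊∈⌋ u A* ∧ ⌊∈⌋ v A ∧ ⌊≡⌋ v (nA u) ∧ not (⌊∈⌋ v (help u))
              ∧ ⌊ (5 // 8) * w v <? contr u v ⌋

  supp : Fin n → Subset n
  supp u = tabulate λ v → ⌊∈⌋ v (NA u) ∧ not (⌊∈⌋ v (help u)) ∧ not (special u v)

  sumContr : Fin n → ℚ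
  sumContr u = Σᵛ (λ v → if ⌊∈⌋ v (NA u) then contr u v else 0ℚ)

module Submission where

-- Write N = N(u, A), x = w(n(u)) for its heaviest weight and L for the left-hand side.  Since
-- contr(u, n(u)) ≥ (w(u)² − w²(N ∖ n(u)))/x, the charge is paid for up to a square:
-- x·L ≥ (x − w(u))² + Σ_{v ∈ N ∖ n(u)} (x·w(v) − w(v)² + x·contr(u, v)), and every summand is
-- nonnegative because w(v) ≤ x.  If n(u) is helpful, supp(u) avoids n(u) (and n₂(u)) and the
-- remaining vertices are light, so their summands are at least (x − ε·w(u))·w(v); if u and n(u)
-- are special neighbours, the summands are at least x·w(v)/4.  Otherwise u ∉ A (for u ∈ A we have
-- N = {u}, which makes u and n(u) special) and 2ξ·w(N) is bounded directly, according to whether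
-- w(N) is large compared with w(u), whether N ∖ n(u) is light (where the square-root condition on
-- ξ enters), and whether N has a second vertex of weight close to x.  Each final step is a
-- polynomial inequality over ℚ, proved by writing the difference as a nonnegative combination of
-- the hypotheses.

open import Data.Fin using (Fin)
open import Data.Fin.Subset using (Subset)
open import Data.Rational using (ℚ; 0ℚ; _<_)
open import Defs using (Graph; Independent; NoClawShapedImprovement; IsChoiceN; IsChoiceN₂)

module OrderedField where
  open import Data.Empty using (⊥-elim)
  open import Data.Rational
  open import Data.Rational.Properties
  open import Data.Sum using (_⊎_; inj₁; inj₂)
  open import Relation.Binary.PropositionalEquality
  open import Relation.Nullary using (yes; no)
  open import Relation.Nullary.Decidable using (True; toWitness)
  open import Data.Rational.Solver using (module +-*-Solver)
  open +-*-Solver using (solve; _:=_; con; _:+_; _:-_; _:*_)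
  open import Defs using (_/'_)

  private
    p+[q-p]≡q : ∀ p q → p + (q - p) ≡ q
    p+[q-p]≡q = solve 2 (λ p q → p :+ (q :- p) := q) refl

  p≤q⇒0≤q-p : ∀ {p q} → p ≤ q → 0ℚ ≤ q - p
  p≤q⇒0≤q-p {p} {q} p≤q = subst (_≤ q - p) (+-inverseʳ p) (+-monoˡ-≤ (- p) p≤q)

  p<q⇒0<q-p : ∀ {p q} → p < q → 0ℚ < q - p
  p<q⇒0<q-p {p} {q} p<q = subst (_< q - p) (+-inverseʳ p) (+-monoˡ-< (- p) p<q)

  0≤q-p⇒p≤q : ∀ {p q} → 0ℚ ≤ q - p → p ≤ q
  0≤q-p⇒p≤q {p} {q} h = subst₂ _≤_ (+-identityʳ p) (p+[q-p]≡q p q) (+-monoʳ-≤ p h)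

  0<q-p⇒p<q : ∀ {p q} → 0ℚ < q - p → p < q
  0<q-p⇒p<q {p} {q} h = subst₂ _<_ (+-identityʳ p) (p+[q-p]≡q p q) (+-monoʳ-< p h)

  ≤-by-difference : ∀ {p q} r → q - p ≡ r → 0ℚ ≤ r → p ≤ q
  ≤-by-difference r q-p≡r 0≤r = 0≤q-p⇒p≤q (subst (0ℚ ≤_) (sym q-p≡r) 0≤r)

  <-by-difference : ∀ {p q} r → q - p ≡ r → 0ℚ < r → p < q
  <-by-difference r q-p≡r 0<r = 0<q-p⇒p<q (subst (0ℚ <_) (sym q-p≡r) 0<r)

  nonNeg-by : ∀ {p} q → p ≡ q → 0ℚ ≤ q → 0ℚ ≤ p
  nonNeg-by q p≡q 0≤q = subst (0ℚ ≤_) (sym p≡q) 0≤q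

  infixl 6 _⊕_
  infixl 7 _⊛_

  _⊕_ : ∀ {p q} → 0ℚ ≤ p → 0ℚ ≤ q → 0ℚ ≤ p + q
  _⊕_ {p} {q} 0≤p 0≤q = subst (_≤ p + q) (+-identityʳ 0ℚ) (+-mono-≤ 0≤p 0≤q)

  _⊛_ : ∀ {p q} → 0ℚ ≤ p → 0ℚ ≤ q → 0ℚ ≤ p * q
  _⊛_ {p} {q} 0≤p 0≤q = subst (_≤ p * q) (*-zeroʳ p) (*-monoˡ-≤-nonNeg p {{nonNegative 0≤p}} 0≤q)

  pos+nonNeg : ∀ {p q} → 0ℚ < p → 0ℚ ≤ q → 0ℚ < p + q
  pos+nonNeg {p} {q} 0<p 0≤q = subst (_< p + q) (+-identityʳ 0ℚ) (+-mono-<-≤ 0<p 0≤q)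

  nonNeg+pos : ∀ {p q} → 0ℚ ≤ p → 0ℚ < q → 0ℚ < p + q
  nonNeg+pos {p} {q} 0≤p 0<q = subst (_< p + q) (+-identityʳ 0ℚ) (+-mono-≤-< 0≤p 0<q)

  pos*pos : ∀ {p q} → 0ℚ < p → 0ℚ < q → 0ℚ < p * q
  pos*pos {p} {q} 0<p 0<q = positive⁻¹ (p * q) {{pos*pos⇒pos p {{positive 0<p}} q {{positive 0<q}}}}

  square-nonNeg : ∀ p → 0ℚ ≤ p * p
  square-nonNeg p with ≤-total 0ℚ p
  ... | inj₁ 0≤p = 0≤p ⊛ 0≤p
  ... | inj₂ p≤0 = subst (0ℚ ≤_) (-p*-p≡p*p p) (p≤q⇒0≤q-p p≤0 ⊛ p≤q⇒0≤q-p p≤0)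
    where
    -p*-p≡p*p : ∀ p → (0ℚ - p) * (0ℚ - p) ≡ p * p
    -p*-p≡p*p = solve 1 (λ p → (con 0ℚ :- p) :* (con 0ℚ :- p) := p :* p) refl

  0≤-decide : ∀ p → {True (0ℚ ≤? p)} → 0ℚ ≤ p
  0≤-decide p {t} = toWitness t

  0<-decide : ∀ p → {True (0ℚ <? p)} → 0ℚ < p
  0<-decide p {t} = toWitness t

  *-cancelˡ-≤ : ∀ {r p q} → 0ℚ < r → r * p ≤ r * q → p ≤ q
  *-cancelˡ-≤ {r} 0<r = *-cancelˡ-≤-pos r {{positive 0<r}}

  *-monoˡ-≤ : ∀ {r p q} → 0ℚ ≤ r → p ≤ q → r * p ≤ r * q
  *-monoˡ-≤ {r} 0≤r = *-monoˡ-≤-nonNeg r {{nonNegative 0≤r}}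

  *-monoʳ-≤ : ∀ {r p q} → 0ℚ ≤ r → p ≤ q → p * r ≤ q * r
  *-monoʳ-≤ {r} 0≤r = *-monoʳ-≤-nonNeg r {{nonNegative 0≤r}}

  nonNeg-factor : ∀ {p q} → 0ℚ < q → 0ℚ ≤ p * q → 0ℚ ≤ p
  nonNeg-factor {p} {q} 0<q h = *-cancelʳ-≤-pos q {{positive 0<q}} (subst (_≤ p * q) (sym (*-zeroˡ q)) h)

  /'-inverse : ∀ p {q} → 0ℚ < q → (p /' q) * q ≡ p
  /'-inverse p {q} 0<q with q ≟ 0ℚ
  ... | yes q≡0 = ⊥-elim (<-irrefl (sym q≡0) 0<q)
  ... | no q≢0 = trans (*-assoc p _ q) (trans (cong (p *_) (*-inverseˡ q {{≢-nonZero q≢0}})) (*-identityʳ p))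

  ≤/'⇒*≤ : ∀ {p q r} → 0ℚ < q → r ≤ p /' q → r * q ≤ p
  ≤/'⇒*≤ {p} {q} {r} 0<q h = subst (r * q ≤_) (/'-inverse p 0<q) (*-monoʳ-≤ (<⇒≤ 0<q) h)

  /'≤⇒≤* : ∀ {p q r} → 0ℚ < q → p /' q ≤ r → p ≤ r * q
  /'≤⇒≤* {p} {q} {r} 0<q h = subst (_≤ r * q) (/'-inverse p 0<q) (*-monoʳ-≤ (<⇒≤ 0<q) h)

  </'⇒*< : ∀ {p q r} → 0ℚ < q → r < p /' q → r * q < p
  </'⇒*< {p} {q} {r} 0<q h = subst (r * q <_) (/'-inverse p 0<q) (*-monoˡ-<-pos q {{positive 0<q}} h)

  <*⇒/'< : ∀ {p q r} → 0ℚ < q → p < r * q → p /' q < r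
  <*⇒/'< {p} {q} {r} 0<q h = *-cancelʳ-<-nonNeg q {{nonNegative (<⇒≤ 0<q)}}
      (subst (_< r * q) (sym (/'-inverse p 0<q)) h)

  ≤-or-> : ∀ p q → p ≤ q ⊎ q < p
  ≤-or-> p q with p ≤? q
  ... | yes p≤q = inj₁ p≤q
  ... | no p≰q = inj₂ (≰⇒> p≰q)

  ≤*⇒/'*≤ : ∀ {p q r} → 0ℚ < q → p ≤ q * r → (1ℚ /' q) * p ≤ r
  ≤*⇒/'*≤ {p} {q} {r} 0<q p≤qr = subst ((1ℚ /' q) * p ≤_) cancel (*-monoˡ-≤ 0≤1/q p≤qr)
    where
    1/q*q≡1 : (1ℚ /' q) * q ≡ 1ℚ
    1/q*q≡1 = /'-inverse 1ℚ 0<q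
    0≤1/q : 0ℚ ≤ 1ℚ /' q
    0≤1/q = nonNeg-factor 0<q (subst (0ℚ ≤_) (sym 1/q*q≡1) (0≤-decide 1ℚ))
    cancel : (1ℚ /' q) * (q * r) ≡ r
    cancel = trans (sym (*-assoc (1ℚ /' q) q r)) (trans (cong (_* r) 1/q*q≡1) (*-identityˡ r))

  rate-bound : ∀ k m {x p L} → 0ℚ < x → 0ℚ ≤ p → k * x ≤ m → m * p ≤ x * L → k * p ≤ L
  rate-bound k m {x} {p} {L} 0<x 0≤p kx≤m mp≤xL =
    *-cancelˡ-≤ 0<x (subst (_≤ x * L) (reassoc k x p) (≤-trans (*-monoʳ-≤ 0≤p kx≤m) mp≤xL))
    where
    reassoc : ∀ k x p → k * x * p ≡ x * (k * p)
    reassoc = solve 3 (λ k x p → k :* x :* p := x :* (k :* p)) refl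

module Subsets where
  open import Data.Bool using (Bool; true; false; T; not; _∧_; _∨_)
  open import Data.Bool.Properties using (T-≡)
  open import Data.Fin using (Fin)
  open import Data.Fin.Properties using (any?)
  open import Data.Fin.Subset using (Subset; _∈_; _∉_; _⊆_; ⁅_⁆; ∁; _∩_; _─_; ∣_∣)
  open import Data.Fin.Subset.Properties
    using (_∈?_; x∈p∩q⁺; x∈p∩q⁻; x∉p⇒x∈∁p; x∈∁p⇒x∉p; x≢y⇒x∉⁅y⁆; x∉⁅y⁆⇒x≢y; x∈⁅y⁆⇒x≡y; ∣⁅x⁆∣≡1;
           x∈p⇒∣p-x∣<∣p∣; p⊆q⇒∣p∣≤∣q∣; x∈p∧x≢y⇒x∈p-y)
  open import Data.Nat as ℕ using ()
  import Data.Nat.Properties as ℕ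
  open import Data.Product using (∃; _×_; _,_)
  open import Data.Sum using (_⊎_; inj₁; inj₂)
  open import Data.Unit using (tt)
  open import Data.Vec using (lookup; tabulate)
  open import Data.Vec.Properties using (lookup∘tabulate; []=⇒lookup; lookup⇒[]=)
  open import Function.Bundles using (Equivalence)
  open import Relation.Binary.PropositionalEquality using (_≢_; trans; sym; subst)
  open import Relation.Nullary using (¬_; Dec; yes; no; contradiction; _×-dec_)

  ∈-∖⁺ : ∀ {n} {X : Subset n} {a i} → i ∈ X → i ≢ a → i ∈ X ∩ ∁ ⁅ a ⁆
  ∈-∖⁺ i∈X i≢a = x∈p∩q⁺ (i∈X , x∉p⇒x∈∁p (x≢y⇒x∉⁅y⁆ i≢a))

  ∈-∖⁻ : ∀ {n} (X : Subset n) a {i} → i ∈ X ∩ ∁ ⁅ a ⁆ → i ∈ X × i ≢ a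
  ∈-∖⁻ X a h with x∈p∩q⁻ X (∁ ⁅ a ⁆) h
  ... | i∈X , i∈∁⁅a⁆ = i∈X , x∉⁅y⁆⇒x≢y (x∈∁p⇒x∉p i∈∁⁅a⁆)

  ⊆-∖ : ∀ {n} {X Y : Subset n} {a} → X ⊆ Y → a ∉ X → X ⊆ Y ∩ ∁ ⁅ a ⁆
  ⊆-∖ {X = X} X⊆Y a∉X i∈X = ∈-∖⁺ (X⊆Y i∈X) λ i≡a → a∉X (subst (_∈ X) i≡a i∈X)

  ∈-tabulate⁺ : ∀ {n} {f : Fin n → Bool} {i} → T (f i) → i ∈ tabulate f
  ∈-tabulate⁺ {f = f} {i} t = lookup⇒[]= i (tabulate f) (trans (lookup∘tabulate f i) (Equivalence.to T-≡ t))

  ∈-tabulate⁻ : ∀ {n} {f : Fin n → Bool} {i} → i ∈ tabulate f → T (f i)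
  ∈-tabulate⁻ {f = f} {i} i∈ = Equivalence.from T-≡ (trans (sym (lookup∘tabulate f i)) ([]=⇒lookup i∈))

  ∈⇒T : ∀ {n} {X : Subset n} {i} → i ∈ X → T (lookup X i)
  ∈⇒T i∈X rewrite []=⇒lookup i∈X = tt

  T⇒∈ : ∀ {n} {X : Subset n} {i} → T (lookup X i) → i ∈ X
  T⇒∈ {X = X} {i} t with lookup X i in eq
  ... | true = lookup⇒[]= i X eq

  ∉⇒T-not : ∀ {n} {X : Subset n} {i} → i ∉ X → T (not (lookup X i))
  ∉⇒T-not {X = X} {i} i∉X with lookup X i in eq
  ... | true = contradiction (lookup⇒[]= i X eq) i∉X
  ... | false = tt

  T-not⇒∉ : ∀ {n} {X : Subset n} {i} → T (not (lookup X i)) → i ∉ X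
  T-not⇒∉ t i∈X = subst (λ b → T (not b)) ([]=⇒lookup i∈X) t

  T-∧⁻ : ∀ a {b} → T (a ∧ b) → T a × T b
  T-∧⁻ true t = _ , t

  T-∨⁻ : ∀ a {b} → T (a ∨ b) → T a ⊎ T b
  T-∨⁻ true t = inj₁ t
  T-∨⁻ false t = inj₂ t

  T-not⇒¬T : ∀ {b} → T (not b) → ¬ T b
  T-not⇒¬T {true} ()

  T-∧⁺ : ∀ a {b} → T a → T b → T (a ∧ b)
  T-∧⁺ true _ t = t

  T-∨⁺ˡ : ∀ a {b} → T a → T (a ∨ b)
  T-∨⁺ˡ true _ = _

  T-∨⁺ʳ : ∀ a {b} → T b → T (a ∨ b)
  T-∨⁺ʳ true _ = _
  T-∨⁺ʳ false t = t

  some-or-none : ∀ {n} (B : Subset n) {P : Fin n → Set} → (∀ i → Dec (P i)) →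
                 (∃ λ i → i ∈ B × P i) ⊎ (∀ {i} → i ∈ B → ¬ P i)
  some-or-none B P? with any? (λ i → i ∈? B ×-dec P? i)
  ... | yes (i , i∈B , Pi) = inj₁ (i , i∈B , Pi)
  ... | no none = inj₂ λ {i} i∈B Pi → none (i , i∈B , Pi)

  two-elements : ∀ {n} {X : Subset n} {a b} → a ∈ X → b ∈ X → b ≢ a → 2 ℕ.≤ ∣ X ∣
  two-elements {X = X} {a} {b} a∈X b∈X b≢a = ℕ.≤-trans (ℕ.s≤s 1≤∣X-a∣) (x∈p⇒∣p-x∣<∣p∣ a∈X)
    where
    1≤∣X-a∣ : 1 ℕ.≤ ∣ X ─ ⁅ a ⁆ ∣
    1≤∣X-a∣ = subst (ℕ._≤ ∣ X ─ ⁅ a ⁆ ∣) (∣⁅x⁆∣≡1 b)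
      (p⊆q⇒∣p∣≤∣q∣ λ {y} y∈⁅b⁆ → subst (_∈ X ─ ⁅ a ⁆) (sym (x∈⁅y⁆⇒x≡y b y∈⁅b⁆)) (x∈p∧x≢y⇒x∈p-y b∈X b≢a))

module Sums where
  open import Data.Bool using (true; false; if_then_else_)
  open import Data.Fin using (Fin; zero; suc; _≟_)
  open import Data.Fin.Subset using (Subset; _∈_; _∉_; _⊆_; ⁅_⁆; ∁; _∩_)
  open import Data.Fin.Subset.Properties using (_∈?_; x∈⁅x⁆; x∈⁅y⁆⇒x≡y)
  open import Data.Nat using (ℕ)
  open import Data.Product using (proj₁; proj₂)
  open import Data.Rational using (ℚ; 0ℚ; _+_; _-_; _*_; _≤_)
  open import Data.Rational.Properties hiding (_≟_)
  open import Data.Vec using (lookup)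
  open import Data.Vec.Properties using ([]=⇒lookup; lookup⇒[]=)
  open import Relation.Binary.PropositionalEquality
  open import Relation.Nullary using (yes; no; does; contradiction)
  open import Data.Rational.Solver using (module +-*-Solver)
  open +-*-Solver using (solve; _:=_; _:+_; _:-_)
  open import Defs using (Σᵛ)
  open OrderedField
  open Subsets

  Σ∈ : ∀ {n} → Subset n → (Fin n → ℚ) → ℚ
  Σ∈ X f = Σᵛ λ i → if lookup X i then f i else 0ℚ

  private
    variable
      n : ℕ

  Σᵛ-cong : ∀ {f g : Fin n → ℚ} → (∀ i → f i ≡ g i) → Σᵛ f ≡ Σᵛ g
  Σᵛ-cong {ℕ.zero} f≡g = refl
  Σᵛ-cong {ℕ.suc n} f≡g = cong₂ _+_ (f≡g zero) (Σᵛ-cong (λ i → f≡g (suc i)))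

  Σᵛ-mono : ∀ {f g : Fin n → ℚ} → (∀ i → f i ≤ g i) → Σᵛ f ≤ Σᵛ g
  Σᵛ-mono {ℕ.zero} f≤g = ≤-refl
  Σᵛ-mono {ℕ.suc n} f≤g = +-mono-≤ (f≤g zero) (Σᵛ-mono (λ i → f≤g (suc i)))

  Σᵛ-zero : Σᵛ {n} (λ _ → 0ℚ) ≡ 0ℚ
  Σᵛ-zero {ℕ.zero} = refl
  Σᵛ-zero {ℕ.suc n} = trans (cong (0ℚ +_) (Σᵛ-zero {n})) (+-identityʳ 0ℚ)

  Σᵛ-+ : ∀ (f g : Fin n → ℚ) → Σᵛ (λ i → f i + g i) ≡ Σᵛ f + Σᵛ g
  Σᵛ-+ {ℕ.zero} f g = sym (+-identityʳ 0ℚ)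
  Σᵛ-+ {ℕ.suc n} f g = trans (cong (f zero + g zero +_) (Σᵛ-+ f′ g′))
                             (interchange (f zero) (g zero) (Σᵛ f′) (Σᵛ g′))
    where
    f′ g′ : Fin n → ℚ
    f′ i = f (suc i)
    g′ i = g (suc i)
    interchange : ∀ a b c d → (a + b) + (c + d) ≡ (a + c) + (b + d)
    interchange = solve 4 (λ a b c d → (a :+ b) :+ (c :+ d) := (a :+ c) :+ (b :+ d)) refl

  Σᵛ-- : ∀ (f g : Fin n → ℚ) → Σᵛ (λ i → f i - g i) ≡ Σᵛ f - Σᵛ g
  Σᵛ-- {ℕ.zero} f g = refl
  Σᵛ-- {ℕ.suc n} f g = trans (cong (f zero - g zero +_) (Σᵛ-- f′ g′))
                             (interchange (f zero) (g zero) (Σᵛ f′) (Σᵛ g′))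
    where
    f′ g′ : Fin n → ℚ
    f′ i = f (suc i)
    g′ i = g (suc i)
    interchange : ∀ a b c d → (a - b) + (c - d) ≡ (a + c) - (b + d)
    interchange = solve 4 (λ a b c d → (a :- b) :+ (c :- d) := (a :+ c) :- (b :+ d)) refl

  Σᵛ-* : ∀ k (f : Fin n → ℚ) → Σᵛ (λ i → k * f i) ≡ k * Σᵛ f
  Σᵛ-* {ℕ.zero} k f = sym (*-zeroʳ k)
  Σᵛ-* {ℕ.suc n} k f = trans (cong (k * f zero +_) (Σᵛ-* k (λ i → f (suc i))))
                             (sym (*-distribˡ-+ k (f zero) (Σᵛ (λ i → f (suc i)))))

  Σᵛ-pick : ∀ a (f : Fin n → ℚ) → Σᵛ f ≡ f a + Σᵛ (λ i → if does (i ≟ a) then 0ℚ else f i)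
  Σᵛ-pick zero f = cong (f zero +_) (sym (+-identityˡ _))
  Σᵛ-pick {ℕ.suc n} (suc a) f =
    trans (cong (f zero +_) (Σᵛ-pick a (λ i → f (suc i)))) (swap (f zero) (f (suc a)) _)
    where
    swap : ∀ a b c → a + (b + c) ≡ b + (a + c)
    swap = solve 3 (λ a b c → a :+ (b :+ c) := b :+ (a :+ c)) refl

  if-∈ : ∀ {X : Subset n} {i} {A : Set} {a b : A} → i ∈ X → (if lookup X i then a else b) ≡ a
  if-∈ i∈X rewrite []=⇒lookup i∈X = refl

  if-∉ : ∀ {X : Subset n} {i} {A : Set} {a b : A} → i ∉ X → (if lookup X i then a else b) ≡ b
  if-∉ {X = X} {i} i∉X with lookup X i in eq
  ... | true = contradiction (lookup⇒[]= i X eq) i∉X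
  ... | false = refl

  Σ∈-mono : ∀ {X : Subset n} {f g} → (∀ {i} → i ∈ X → f i ≤ g i) → Σ∈ X f ≤ Σ∈ X g
  Σ∈-mono {X = X} {f} {g} f≤g = Σᵛ-mono pointwise
    where
    pointwise : ∀ i → (if lookup X i then f i else 0ℚ) ≤ (if lookup X i then g i else 0ℚ)
    pointwise i with i ∈? X
    ... | yes i∈X = subst₂ _≤_ (sym (if-∈ i∈X)) (sym (if-∈ i∈X)) (f≤g i∈X)
    ... | no i∉X = subst₂ _≤_ (sym (if-∉ i∉X)) (sym (if-∉ i∉X)) ≤-refl

  Σ∈-zero : ∀ (X : Subset n) → Σ∈ X (λ _ → 0ℚ) ≡ 0ℚ
  Σ∈-zero {n} X = trans (Σᵛ-cong (λ i → pointwise (lookup X i))) (Σᵛ-zero {n})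
    where
    pointwise : ∀ b → (if b then 0ℚ else 0ℚ) ≡ 0ℚ
    pointwise true = refl
    pointwise false = refl

  Σ∈-nonNeg : ∀ {X : Subset n} {f} → (∀ {i} → i ∈ X → 0ℚ ≤ f i) → 0ℚ ≤ Σ∈ X f
  Σ∈-nonNeg {X = X} {f} 0≤f = subst (_≤ Σ∈ X f) (Σ∈-zero X) (Σ∈-mono 0≤f)

  Σ∈-empty : ∀ {X : Subset n} {f} → (∀ i → i ∉ X) → Σ∈ X f ≡ 0ℚ
  Σ∈-empty {n} i∉X = trans (Σᵛ-cong (λ i → if-∉ (i∉X i))) (Σᵛ-zero {n})

  Σ∈-⊆ : ∀ {X Y : Subset n} {f} → X ⊆ Y → (∀ {i} → i ∈ Y → 0ℚ ≤ f i) → Σ∈ X f ≤ Σ∈ Y f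
  Σ∈-⊆ {X = X} {Y} {f} X⊆Y 0≤f = Σᵛ-mono pointwise
    where
    pointwise : ∀ i → (if lookup X i then f i else 0ℚ) ≤ (if lookup Y i then f i else 0ℚ)
    pointwise i with i ∈? X | i ∈? Y
    ... | yes i∈X | _ = subst₂ _≤_ (sym (if-∈ i∈X)) (sym (if-∈ (X⊆Y i∈X))) ≤-refl
    ... | no i∉X | yes i∈Y = subst₂ _≤_ (sym (if-∉ i∉X)) (sym (if-∈ i∈Y)) (0≤f i∈Y)
    ... | no i∉X | no i∉Y = subst₂ _≤_ (sym (if-∉ i∉X)) (sym (if-∉ i∉Y)) ≤-refl

  Σ∈-+ : ∀ (X : Subset n) f g → Σ∈ X (λ i → f i + g i) ≡ Σ∈ X f + Σ∈ X g
  Σ∈-+ {n} X f g = trans (Σᵛ-cong (λ i → pointwise (lookup X i))) (Σᵛ-+ {n} _ _)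
    where
    pointwise : ∀ {i} b → (if b then f i + g i else 0ℚ) ≡ (if b then f i else 0ℚ) + (if b then g i else 0ℚ)
    pointwise true = refl
    pointwise false = sym (+-identityʳ 0ℚ)

  Σ∈-- : ∀ (X : Subset n) f g → Σ∈ X (λ i → f i - g i) ≡ Σ∈ X f - Σ∈ X g
  Σ∈-- {n} X f g = trans (Σᵛ-cong (λ i → pointwise (lookup X i))) (Σᵛ-- {n} _ _)
    where
    pointwise : ∀ {i} b → (if b then f i - g i else 0ℚ) ≡ (if b then f i else 0ℚ) - (if b then g i else 0ℚ)
    pointwise true = refl
    pointwise false = refl

  Σ∈-* : ∀ (X : Subset n) k f → Σ∈ X (λ i → k * f i) ≡ k * Σ∈ X f
  Σ∈-* {n} X k f = trans (Σᵛ-cong (λ i → pointwise (lookup X i))) (Σᵛ-* {n} k _)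
    where
    pointwise : ∀ {i} b → (if b then k * f i else 0ℚ) ≡ k * (if b then f i else 0ℚ)
    pointwise true = refl
    pointwise false = sym (*-zeroʳ k)

  Σ∈-remove : ∀ {X : Subset n} {a} f → a ∈ X → Σ∈ X f ≡ f a + Σ∈ (X ∩ ∁ ⁅ a ⁆) f
  Σ∈-remove {n} {X} {a} f a∈X =
    trans (Σᵛ-pick {n} a _) (cong₂ _+_ (if-∈ a∈X) (Σᵛ-cong pointwise))
    where
    pointwise : ∀ i → (if does (i ≟ a) then 0ℚ else (if lookup X i then f i else 0ℚ))
                      ≡ (if lookup (X ∩ ∁ ⁅ a ⁆) i then f i else 0ℚ)
    pointwise i with i ≟ a | i ∈? X
    ... | yes refl | _ = sym (if-∉ {X = X ∩ ∁ ⁅ a ⁆} λ a∈X∖a → proj₂ (∈-∖⁻ X a a∈X∖a) refl)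
    ... | no i≢a | yes i∈X = trans (if-∈ i∈X) (sym (if-∈ (∈-∖⁺ i∈X i≢a)))
    ... | no _ | no i∉X = trans (if-∉ i∉X) (sym (if-∉ {X = X ∩ ∁ ⁅ a ⁆} λ i∈X∖a → i∉X (proj₁ (∈-∖⁻ X a i∈X∖a))))

  Σ∈-⁅⁆ : ∀ a (f : Fin n → ℚ) → Σ∈ ⁅ a ⁆ f ≡ f a
  Σ∈-⁅⁆ a f = trans (Σ∈-remove f (x∈⁅x⁆ a))
    (trans (cong (f a +_) (Σ∈-empty {X = ⁅ a ⁆ ∩ ∁ ⁅ a ⁆} λ i i∈ → proj₂ (∈-∖⁻ ⁅ a ⁆ a i∈)
        (x∈⁅y⁆⇒x≡y a (proj₁ (∈-∖⁻ ⁅ a ⁆ a i∈)))))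
           (+-identityʳ (f a)))

  term≤Σ∈ : ∀ {X : Subset n} {a} f → a ∈ X → (∀ {i} → i ∈ X → 0ℚ ≤ f i) → f a ≤ Σ∈ X f
  term≤Σ∈ {X = X} {a} f a∈X 0≤f = subst (f a ≤_) (sym (Σ∈-remove f a∈X))
    (subst (_≤ f a + Σ∈ (X ∩ ∁ ⁅ a ⁆) f) (+-identityʳ (f a))
           (+-monoʳ-≤ (f a) (Σ∈-nonNeg {X = X ∩ ∁ ⁅ a ⁆} (λ i∈ → 0≤f (proj₁ (∈-∖⁻ X a i∈))))))

module ExcessBounds where
  open import Data.Rational using (ℚ; 0ℚ; 1ℚ; ½; _+_; _-_; _*_; _≤_; _<_; _≤?_)
  open import Data.Rational.Properties using (<⇒≤; ≰⇒>)
  open import Relation.Binary.PropositionalEquality using (_≡_; refl; cong; subst)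
  open import Relation.Nullary using (yes; no)
  open import Data.Rational.Solver using (module +-*-Solver)
  open +-*-Solver using (solve; _:=_; con; _:+_; _:-_; _:*_)
  open import Defs using (_//_)
  open OrderedField

  excess : ℚ → ℚ → ℚ → ℚ
  excess x y c = x * y - y * y + x * c

  excess-nonNeg : ∀ {x y c} → 0ℚ ≤ x → 0ℚ ≤ y → y ≤ x → 0ℚ ≤ c → 0ℚ ≤ excess x y c
  excess-nonNeg {x} {y} {c} 0≤x 0≤y y≤x 0≤c =
    nonNeg-by _ (identity x y c) (0≤y ⊛ p≤q⇒0≤q-p y≤x ⊕ 0≤x ⊛ 0≤c)
    where
    identity : ∀ x y c → x * y - y * y + x * c ≡ y * (x - y) + x * c
    identity = solve 3 (λ x y c → x :* y :- y :* y :+ x :* c := y :* (x :- y) :+ x :* c) refl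

  excess-≥-light : ∀ {x y c} m → 0ℚ ≤ x → 0ℚ ≤ y → y ≤ m → 0ℚ ≤ c → (x - m) * y ≤ excess x y c
  excess-≥-light {x} {y} {c} m 0≤x 0≤y y≤m 0≤c =
    ≤-by-difference _ (identity x y c m) (0≤y ⊛ p≤q⇒0≤q-p y≤m ⊕ 0≤x ⊛ 0≤c)
    where
    identity : ∀ x y c m → x * y - y * y + x * c - (x - m) * y ≡ y * (m - y) + x * c
    identity = solve 4 (λ x y c m →
      x :* y :- y :* y :+ x :* c :- (x :- m) :* y
      := y :* (m :- y) :+ x :* c) refl

  excess-≥-half : ∀ {x y c} → 0ℚ ≤ x → 0ℚ ≤ y → y ≤ x * ½ → 0ℚ ≤ c → (x * ½) * y ≤ excess x y c
  excess-≥-half {x} {y} {c} 0≤x 0≤y y≤x/2 0≤c =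
    subst (_≤ excess x y c) (cong (_* y) (identity x)) (excess-≥-light (x * ½) 0≤x 0≤y y≤x/2 0≤c)
    where
    identity : ∀ x → x - x * ½ ≡ x * ½
    identity = solve 1 (λ x → x :- x :* con ½ := x :* con ½) refl

  excess-≥-far : ∀ {x y c} ε → 0ℚ ≤ ε → 0ℚ ≤ x → 0ℚ ≤ y → (1ℚ + ε) * y ≤ x → 0ℚ ≤ c →
                 ε * x * y ≤ (1ℚ + ε) * excess x y c
  excess-≥-far {x} {y} {c} ε 0≤ε 0≤x 0≤y [1+ε]y≤x 0≤c =
    ≤-by-difference _ (identity x y c ε) (0≤y ⊛ p≤q⇒0≤q-p [1+ε]y≤x ⊕ (0≤-decide 1ℚ ⊕ 0≤ε) ⊛ 0≤x ⊛ 0≤c)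
    where
    identity : ∀ x y c ε → (1ℚ + ε) * (x * y - y * y + x * c) - ε * x * y
                           ≡ y * (x - (1ℚ + ε) * y) + (1ℚ + ε) * x * c
    identity = solve 4 (λ x y c ε →
      (con 1ℚ :+ ε) :* (x :* y :- y :* y :+ x :* c) :- ε :* x :* y
      := y :* (x :- (con 1ℚ :+ ε) :* y) :+ (con 1ℚ :+ ε) :* x :* c) refl

  excess-≥-gap : ∀ {x y c} → 0ℚ ≤ x → 0ℚ ≤ c → y * (x - y) ≤ excess x y c
  excess-≥-gap {x} {y} {c} 0≤x 0≤c = ≤-by-difference _ (identity x y c) (0≤x ⊛ 0≤c)
    where
    identity : ∀ x y c → x * y - y * y + x * c - y * (x - y) ≡ x * c
    identity = solve 3 (λ x y c → x :* y :- y :* y :+ x :* c :- y :* (x :- y) := x :* c) refl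

  excess-≥-quarter : ∀ {x y c D} → 0ℚ < x → 0ℚ < y → y ≤ x → 0ℚ ≤ c →
                     y * y - D ≤ y * c → 8 // 1 * D < 3 // 1 * (x * x) → x * (1 // 4) * y ≤ excess x y c
  excess-≥-quarter {x} {y} {c} {D} 0<x 0<y y≤x 0≤c yc-bound D-small with 4 // 1 * y ≤? 3 // 1 * x
  ... | yes 4y≤3x = ≤-by-difference _ (small-y x y c)
      (<⇒≤ 0<y ⊛ (p≤q⇒0≤q-p 4y≤3x ⊛ 0≤-decide (1 // 4)) ⊕ <⇒≤ 0<x ⊛ 0≤c)
    where
    small-y : ∀ x y c → x * y - y * y + x * c - x * (1 // 4) * y ≡ y *
        ((3 // 1 * x - 4 // 1 * y) * (1 // 4)) + x * c
    small-y = solve 3 (λ x y c →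
      x :* y :- y :* y :+ x :* c :- x :* con (1 // 4) :* y
      := y :* ((con (3 // 1) :* x :- con (4 // 1) :* y) :* con (1 // 4)) :+ x :* c) refl
  ... | no 4y≰3x = ≤-by-difference _ (large-y x y c) (<⇒≤ 0<y ⊛ p≤q⇒0≤q-p y≤x ⊕ <⇒≤ 0<x ⊛ 0≤c-y/4)
    where
    large-y : ∀ x y c → x * y - y * y + x * c - x * (1 // 4) * y ≡ y * (x - y) + x * (c - y * (1 // 4))
    large-y = solve 3 (λ x y c →
      x :* y :- y :* y :+ x :* c :- x :* con (1 // 4) :* y
      := y :* (x :- y) :+ x :* (c :- y :* con (1 // 4))) refl
    split : ∀ x y c D → y * c - y * y * (1 // 4)
            ≡ (y * c - (y * y - D)) + 3 // 8 * ((4 // 1 * y - 3 // 1 * x) * (4 // 1 * y + 3 // 1 * x) * (1 // 9)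
                                                + 2 // 9 * (y * y))
              + (3 // 1 * (x * x) - 8 // 1 * D) * (1 // 8)
    split = solve 4 (λ x y c D →
      y :* c :- y :* y :* con (1 // 4)
      := (y :* c :- (y :* y :- D))
         :+ con (3 // 8) :* ((con (4 // 1) :* y :- con (3 // 1) :* x) :*
             (con (4 // 1) :* y :+ con (3 // 1) :* x) :* con (1 // 9) :+ con (2 // 9) :* (y :* y))
         :+ (con (3 // 1) :* (x :* x) :- con (8 // 1) :* D) :* con (1 // 8)) refl
    factor : ∀ y c → y * c - y * y * (1 // 4) ≡ (c - y * (1 // 4)) * y
    factor = solve 2 (λ y c → y :* c :- y :* y :* con (1 // 4) := (c :- y :* con (1 // 4)) :* y) refl
    0≤yc-y²/4 : 0ℚ ≤ y * c - y * y * (1 // 4)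
    0≤yc-y²/4 = nonNeg-by _ (split x y c D)
      (p≤q⇒0≤q-p yc-bound
       ⊕ 0≤-decide (3 // 8) ⊛ (p≤q⇒0≤q-p (<⇒≤ (≰⇒> 4y≰3x)) ⊛
           (0≤-decide (4 // 1) ⊛ <⇒≤ 0<y ⊕ 0≤-decide (3 // 1) ⊛ <⇒≤ 0<x) ⊛ 0≤-decide (1 // 9)
                             ⊕ 0≤-decide (2 // 9) ⊛ (<⇒≤ 0<y ⊛ <⇒≤ 0<y))
       ⊕ p≤q⇒0≤q-p (<⇒≤ D-small) ⊛ 0≤-decide (1 // 8))
    0≤c-y/4 : 0ℚ ≤ c - y * (1 // 4)
    0≤c-y/4 = nonNeg-factor 0<y (subst (0ℚ ≤_) (factor y c) 0≤yc-y²/4)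

module ConstantBounds where
  open import Data.Rational using (ℚ; 0ℚ; 1ℚ; ½; _+_; _-_; _*_; _≤_; _<_)
  open import Data.Rational.Properties using (<⇒≤)
  open import Data.Product using (_,_)
  open import Relation.Binary.PropositionalEquality using (_≡_; refl)
  open import Data.Rational.Solver using (module +-*-Solver)
  open +-*-Solver using (solve; _:=_; con; _:+_; _:-_; _:*_)
  open import Defs using (_//_; _/'_; sq; Constants)
  open OrderedField

  record Bounds (ε ξ : ℚ) : Set where
    field
      ε-pos : 0ℚ < ε
      ξ-pos : 0ℚ < ξ
      7ε≤1 : 7 // 1 * ε ≤ 1ℚ
      2ξ≤1-2ε : 2 // 1 * ξ ≤ 1ℚ - 2 // 1 * ε
      ξ-small : ξ * (4 // 1 * (2 // 1 + ε)) ≤ ε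
      root-condition : ∀ s → 0ℚ ≤ s → sq (1ℚ - s) /' (1ℚ + ε * s) < 2 // 1 * ξ →
                       5 // 1 /' (8 // 1 * (1ℚ - sq ε)) ≤ sq s

  constants⇒bounds : ∀ {ε ξ} → Constants ε ξ → Bounds ε ξ
  constants⇒bounds {ε} {ξ} (0<ε , 0<ξ , _ , _ , quadratic≤1 , _ , _ , ξ≤[1-2ε-2ε²]/2 , root , _ , _ , _ , _
      , _ , ξ≤ε/4[2+ε] , _) = record
    { ε-pos = 0<ε
    ; ξ-pos = 0<ξ
    ; 7ε≤1 = 0≤q-p⇒p≤q (nonNeg-factor 0<[1+ε]/4 (nonNeg-by _ (factor ε) (p≤q⇒0≤q-p quadratic≤1)))
    ; 2ξ≤1-2ε = ≤-by-difference _ (regroup ε ξ)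
                  (0≤-decide (2 // 1) ⊛ p≤q⇒0≤q-p ξ≤[1-2ε-2ε²]/2 ⊕ 0≤-decide (2 // 1) ⊛ square-nonNeg ε)
    ; ξ-small = ≤/'⇒*≤ (pos*pos (0<-decide (4 // 1)) (pos+nonNeg (0<-decide (2 // 1)) (<⇒≤ 0<ε))) ξ≤ε/4[2+ε]
    ; root-condition = root
    }
    where
    0<[1+ε]/4 : 0ℚ < (1ℚ + ε) * (1 // 4)
    0<[1+ε]/4 = pos*pos (pos+nonNeg (0<-decide 1ℚ) (<⇒≤ 0<ε)) (0<-decide (1 // 4))
    factor : ∀ e → (1ℚ - 7 // 1 * e) * ((1ℚ + e) * (1 // 4)) ≡ 1ℚ - (3 // 4 * ((1ℚ + e) * (1ℚ + e)) + e * e)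
    factor = solve 1 (λ e →
      (con 1ℚ :- con (7 // 1) :* e) :* ((con 1ℚ :+ e) :* con (1 // 4))
      := con 1ℚ :- (con (3 // 4) :* ((con 1ℚ :+ e) :* (con 1ℚ :+ e)) :+ e :* e)) refl
    regroup : ∀ e x → 1ℚ - 2 // 1 * e - 2 // 1 * x
                      ≡ 2 // 1 * ((1ℚ - 2 // 1 * e * (1ℚ + e)) * ½ - x) + 2 // 1 * (e * e)
    regroup = solve 2 (λ e x →
      con 1ℚ :- con (2 // 1) :* e :- con (2 // 1) :* x
      := con (2 // 1) :* ((con 1ℚ :- con (2 // 1) :* e :* (con 1ℚ :+ e)) :* con ½ :- x)
         :+ con (2 // 1) :* (e :* e)) refl

module Consequences {ε ξ : ℚ} (bounds : ConstantBounds.Bounds ε ξ) where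
  open import Data.Empty using (⊥-elim)
  open import Data.Rational using (1ℚ; ½; _+_; _-_; _*_; _≤_; _≤?_; _<?_)
  open import Data.Rational.Properties using (<⇒≤; ≰⇒>; ≮⇒≥; <-irrefl; ≤-<-trans; <-≤-trans; *-comm;
      *-zeroʳ; ≤-antisym)
  open import Relation.Binary.PropositionalEquality using (_≡_; refl; sym; trans; subst; subst₂)
  open import Relation.Nullary using (yes; no)
  open import Data.Rational.Solver using (module +-*-Solver)
  open +-*-Solver using (solve; _:=_; con; _:+_; _:-_; _:*_)
  open import Defs using (_//_; _/'_)
  open OrderedField
  open ConstantBounds.Bounds bounds

  0≤ε : 0ℚ ≤ ε
  0≤ε = <⇒≤ ε-pos

  0≤ξ : 0ℚ ≤ ξ
  0≤ξ = <⇒≤ ξ-pos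

  0<1+ε : 0ℚ < 1ℚ + ε
  0<1+ε = pos+nonNeg (0<-decide 1ℚ) 0≤ε

  0≤1-ε : 0ℚ ≤ 1ℚ - ε
  0≤1-ε = nonNeg-by _ (identity ε) (p≤q⇒0≤q-p 7ε≤1 ⊕ 0≤-decide (6 // 1) ⊛ 0≤ε)
    where
    identity : ∀ e → 1ℚ - e ≡ 1ℚ - 7 // 1 * e + 6 // 1 * e
    identity = solve 1 (λ e → con 1ℚ :- e := con 1ℚ :- con (7 // 1) :* e :+ con (6 // 1) :* e) refl

  56ξ≤1 : 56 // 1 * ξ ≤ 1ℚ
  56ξ≤1 = ≤-by-difference _ (identity ξ ε)
    (0≤-decide (7 // 1) ⊛ p≤q⇒0≤q-p ξ-small ⊕ p≤q⇒0≤q-p 7ε≤1 ⊕ 0≤-decide (28 // 1) ⊛ 0≤ξ ⊛ 0≤ε)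
    where
    identity : ∀ x e → 1ℚ - 56 // 1 * x ≡ 7 // 1 * (e - x * (4 // 1 * (2 // 1 + e))) + (1ℚ - 7 // 1 * e) +
        28 // 1 * x * e
    identity = solve 2 (λ x e →
      con 1ℚ :- con (56 // 1) :* x
      := con (7 // 1) :* (e :- x :* (con (4 // 1) :* (con (2 // 1) :+ e)))
         :+ (con 1ℚ :- con (7 // 1) :* e) :+ con (28 // 1) :* x :* e) refl

  1+7ε-nonNeg : 0ℚ ≤ 1ℚ + 7 // 1 * ε
  1+7ε-nonNeg = 0≤-decide 1ℚ ⊕ 0≤-decide (7 // 1) ⊛ 0≤ε

  0<8[1-ε²] : 0ℚ < 8 // 1 * (1ℚ - ε * ε)
  0<8[1-ε²] = <-by-difference _ (identity ε)
    (pos+nonNeg (0<-decide (8 // 1 * (48 // 49))) (0≤-decide (8 // 49) ⊛ (p≤q⇒0≤q-p 7ε≤1 ⊛ 1+7ε-nonNeg)))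
    where
    identity : ∀ e → 8 // 1 * (1ℚ - e * e) - 0ℚ ≡ 8 // 1 * (48 // 49) + 8 // 49 *
        ((1ℚ - 7 // 1 * e) * (1ℚ + 7 // 1 * e))
    identity = solve 1 (λ e →
      con (8 // 1) :* (con 1ℚ :- e :* e) :- con 0ℚ
      := con (8 // 1) :* con (48 // 49)
         :+ con (8 // 49) :* ((con 1ℚ :- con (7 // 1) :* e) :* (con 1ℚ :+ con (7 // 1) :* e))) refl

  root-open : ∀ s → 0ℚ ≤ s → 8 // 1 * (1ℚ - ε * ε) * (s * s) < 5 // 1 →
              2 // 1 * ξ * (1ℚ + ε * s) ≤ (1ℚ - s) * (1ℚ - s)
  root-open s 0≤s below with 2 // 1 * ξ * (1ℚ + ε * s) ≤? (1ℚ - s) * (1ℚ - s)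
  ... | yes ok = ok
  ... | no not-ok = ⊥-elim (<-irrefl refl (≤-<-trans 5≤ (subst (_< 5 // 1) (*-comm _ (s * s)) below)))
    where
    0<1+εs : 0ℚ < 1ℚ + ε * s
    0<1+εs = pos+nonNeg (0<-decide 1ℚ) (0≤ε ⊛ 0≤s)
    5≤ : 5 // 1 ≤ s * s * (8 // 1 * (1ℚ - ε * ε))
    5≤ = /'≤⇒≤* 0<8[1-ε²] (root-condition s 0≤s (<*⇒/'< 0<1+εs (≰⇒> not-ok)))

  root-region-≤1 : ∀ s → 0ℚ ≤ s → 8 // 1 * (1ℚ - ε * ε) * (s * s) ≤ 5 // 1 → s ≤ 1ℚ
  root-region-≤1 s 0≤s within with s ≤? 1ℚ
  ... | yes s≤1 = s≤1
  ... | no s≰1 = ⊥-elim (<-irrefl refl (≤-<-trans within 5<))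
    where
    identity : ∀ s e → 8 // 1 * (1ℚ - e * e) * (s * s) - 5 // 1
                       ≡ 8 // 1 * (1ℚ - e * e) * ((s - 1ℚ) * (s + 1ℚ))
                         + (3 // 1 - 8 // 49 + 8 // 49 * ((1ℚ - 7 // 1 * e) * (1ℚ + 7 // 1 * e)))
    identity = solve 2 (λ s e →
      con (8 // 1) :* (con 1ℚ :- e :* e) :* (s :* s) :- con (5 // 1)
      := con (8 // 1) :* (con 1ℚ :- e :* e) :* ((s :- con 1ℚ) :* (s :+ con 1ℚ))
         :+ (con (3 // 1) :- con (8 // 49) :+ con (8 // 49) :*
             ((con 1ℚ :- con (7 // 1) :* e) :* (con 1ℚ :+ con (7 // 1) :* e)))) refl
    5< : 5 // 1 < 8 // 1 * (1ℚ - ε * ε) * (s * s)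
    5< = <-by-difference _ (identity s ε)
      (nonNeg+pos (<⇒≤ 0<8[1-ε²] ⊛ (p≤q⇒0≤q-p (<⇒≤ (≰⇒> s≰1)) ⊛ (0≤s ⊕ 0≤-decide 1ℚ)))
                  (pos+nonNeg (0<-decide (3 // 1 - 8 // 49))
                      (0≤-decide (8 // 49) ⊛ (p≤q⇒0≤q-p 7ε≤1 ⊛ 1+7ε-nonNeg))))

  gap inward : ℚ → ℚ
  gap s = 2 // 1 * ξ * (1ℚ + ε * s) - (1ℚ - s) * (1ℚ - s)
  inward s = s - gap s * s * (1 // 8)

  0≤1-εs : ∀ {s} → s ≤ 1ℚ → 0ℚ ≤ 1ℚ - ε * s
  0≤1-εs {s} s≤1 = nonNeg-by _ (identity ε s)
    (p≤q⇒0≤q-p 7ε≤1 ⊛ 0≤-decide (1 // 7) ⊕ 0≤-decide (6 // 7) ⊕ 0≤ε ⊛ p≤q⇒0≤q-p s≤1)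
    where
    identity : ∀ e s → 1ℚ - e * s ≡ (1ℚ - 7 // 1 * e) * (1 // 7) + 6 // 7 + e * (1ℚ - s)
    identity = solve 2 (λ e s →
      con 1ℚ :- e :* s
      := (con 1ℚ :- con (7 // 1) :* e) :* con (1 // 7) :+ con (6 // 7) :+ e :* (con 1ℚ :- s)) refl

  gap≤8 : ∀ {s} → s ≤ 1ℚ → 0ℚ ≤ 8 // 1 - gap s
  gap≤8 {s} s≤1 = nonNeg-by _ (identity ξ ε s)
    (square-nonNeg (1ℚ - s) ⊕ 0≤-decide (2 // 1) ⊛ 0≤ξ ⊛ 0≤1-εs s≤1
     ⊕ p≤q⇒0≤q-p 56ξ≤1 ⊛ 0≤-decide (1 // 14) ⊕ 0≤-decide (111 // 14))
    where
    identity : ∀ x e s → 8 // 1 - (2 // 1 * x * (1ℚ + e * s) - (1ℚ - s) * (1ℚ - s))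
                         ≡ (1ℚ - s) * (1ℚ - s) + 2 // 1 * x * (1ℚ - e * s)
                           + (1ℚ - 56 // 1 * x) * (1 // 14) + 111 // 14
    identity = solve 3 (λ x e s →
      con (8 // 1) :- (con (2 // 1) :* x :* (con 1ℚ :+ e :* s) :- (con 1ℚ :- s) :* (con 1ℚ :- s))
      := (con 1ℚ :- s) :* (con 1ℚ :- s) :+ con (2 // 1) :* x :* (con 1ℚ :- e :* s)
         :+ (con 1ℚ :- con (56 // 1) :* x) :* con (1 // 14) :+ con (111 // 14)) refl

  0≤inward : ∀ {s} → 0ℚ ≤ s → s ≤ 1ℚ → 0ℚ ≤ inward s
  0≤inward {s} 0≤s s≤1 = nonNeg-by _ (identity (gap s) s) (0≤s ⊛ (gap≤8 s≤1 ⊛ 0≤-decide (1 // 8)))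
    where
    identity : ∀ g s → s - g * s * (1 // 8) ≡ s * ((8 // 1 - g) * (1 // 8))
    identity = solve 2 (λ g s → s :- g :* s :* con (1 // 8) := s :* ((con (8 // 1) :- g) :* con (1 // 8))) refl

  inward-inside : ∀ {s} → 0ℚ < s → s ≤ 1ℚ → 0ℚ < gap s →
                  8 // 1 * (1ℚ - ε * ε) * (inward s * inward s) < 8 // 1 * (1ℚ - ε * ε) * (s * s)
  inward-inside {s} 0<s s≤1 0<gap = <-by-difference _ (identity (8 // 1 * (1ℚ - ε * ε)) (gap s) s)
    (pos*pos (pos*pos 0<8[1-ε²] (pos*pos (pos*pos (pos*pos 0<gap 0<s) 0<s) (0<-decide (1 // 8))))
             (pos+nonNeg (0<-decide 1ℚ) (gap≤8 s≤1 ⊛ 0≤-decide (1 // 8))))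
    where
    identity : ∀ d g s → d * (s * s) - d * ((s - g * s * (1 // 8)) * (s - g * s * (1 // 8)))
                         ≡ d * (g * s * s * (1 // 8)) * (1ℚ + (8 // 1 - g) * (1 // 8))
    identity = solve 3 (λ d g s →
      d :* (s :* s) :- d :* ((s :- g :* s :* con (1 // 8)) :* (s :- g :* s :* con (1 // 8)))
      := d :* (g :* s :* s :* con (1 // 8)) :* (con 1ℚ :+ (con (8 // 1) :- g) :* con (1 // 8))) refl

  -- Moving s inward by δ = gap(s)·s/8 changes the gap by −δ·(2(1 − s) + δ + 2ξε), at most half of it.
  gap-persists : ∀ {s} → 0ℚ ≤ s → s ≤ 1ℚ → 0ℚ < gap s →
                 (1ℚ - inward s) * (1ℚ - inward s) < 2 // 1 * ξ * (1ℚ + ε * inward s)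
  gap-persists {s} 0≤s s≤1 0<gap =
    <-by-difference _ (trans (perturb ξ ε s (gap s * s * (1 // 8))) (factor (gap s) s ξ ε))
      (pos*pos 0<gap
        (pos+nonNeg (0<-decide ½)
          (p≤q⇒0≤q-p s≤1 ⊛ 0≤-decide (1 // 4) ⊕ 0≤s ⊛ 0≤s ⊛ 0≤-decide (1 // 4)
           ⊕ gap≤8 s≤1 ⊛ (0≤s ⊛ 0≤s) ⊛ 0≤-decide (1 // 64)
           ⊕ p≤q⇒0≤q-p s≤1 ⊛ (0≤-decide 1ℚ ⊕ 0≤s) ⊛ 0≤-decide (1 // 8)
           ⊕ 0≤½-ξεs ⊛ 0≤-decide (1 // 4))))
    where
    perturb : ∀ x e s d → 2 // 1 * x * (1ℚ + e * (s - d)) - (1ℚ - (s - d)) * (1ℚ - (s - d))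
                          ≡ (2 // 1 * x * (1ℚ + e * s) - (1ℚ - s) * (1ℚ - s))
                            - d * (2 // 1 * (1ℚ - s) + d + 2 // 1 * x * e)
    perturb = solve 4 (λ x e s d →
      con (2 // 1) :* x :* (con 1ℚ :+ e :* (s :- d)) :- (con 1ℚ :- (s :- d)) :* (con 1ℚ :- (s :- d))
      := (con (2 // 1) :* x :* (con 1ℚ :+ e :* s) :- (con 1ℚ :- s) :* (con 1ℚ :- s))
         :- d :* (con (2 // 1) :* (con 1ℚ :- s) :+ d :+ con (2 // 1) :* x :* e)) refl
    factor : ∀ g s x e → g - g * s * (1 // 8) * (2 // 1 * (1ℚ - s) + g * s * (1 // 8) + 2 // 1 * x * e)
                         ≡ g * (½ + ((1ℚ - s) * (1 // 4) + s * s * (1 // 4)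
                                     + (8 // 1 - g) * (s * s) * (1 // 64)
                                     + (1ℚ - s) * (1ℚ + s) * (1 // 8)
                                     + (½ - x * e * s) * (1 // 4)))
    factor = solve 4 (λ g s x e →
      g :- g :* s :* con (1 // 8) :* (con (2 // 1) :* (con 1ℚ :- s) :+ g :* s :* con (1 // 8) :+ con
          (2 // 1) :* x :* e)
      := g :* (con ½ :+ ((con 1ℚ :- s) :* con (1 // 4) :+ s :* s :* con (1 // 4)
                         :+ (con (8 // 1) :- g) :* (s :* s) :* con (1 // 64)
                         :+ (con 1ℚ :- s) :* (con 1ℚ :+ s) :* con (1 // 8)
                         :+ (con ½ :- x :* e :* s) :* con (1 // 4)))) refl
    0≤½-ξεs : 0ℚ ≤ ½ - ξ * ε * s
    0≤½-ξεs = nonNeg-by _ (identity ξ ε s)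
                (p≤q⇒0≤q-p 56ξ≤1 ⊛ 0≤-decide (1 // 56) ⊕ 0≤-decide (27 // 56) ⊕ 0≤ξ ⊛ 0≤1-εs s≤1)
      where
      identity : ∀ x e s → ½ - x * e * s ≡ (1ℚ - 56 // 1 * x) * (1 // 56) + 27 // 56 + x * (1ℚ - e * s)
      identity = solve 3 (λ x e s →
        con ½ :- x :* e :* s
        := (con 1ℚ :- con (56 // 1) :* x) :* con (1 // 56) :+ con (27 // 56) :+ x :* (con 1ℚ :- e :* s)) refl

  -- The root condition is only assumed where it is strict; a violation on the boundary
  -- would persist at the strictly interior point inward s.
  root-closed : ∀ s → 0ℚ ≤ s → 8 // 1 * (1ℚ - ε * ε) * (s * s) ≤ 5 // 1 →
                2 // 1 * ξ * (1ℚ + ε * s) ≤ (1ℚ - s) * (1ℚ - s)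
  root-closed s 0≤s within with 2 // 1 * ξ * (1ℚ + ε * s) ≤? (1ℚ - s) * (1ℚ - s) | 0ℚ <? s
  ... | yes ok | _ = ok
  ... | no _ | no s≯0 = root-open s 0≤s (subst (λ t → 8 // 1 * (1ℚ - ε * ε) * (t * t) < 5 // 1)
                                                (≤-antisym 0≤s (≮⇒≥ s≯0)) at-0)
    where
    at-0 : 8 // 1 * (1ℚ - ε * ε) * (0ℚ * 0ℚ) < 5 // 1
    at-0 = subst (_< 5 // 1) (sym (*-zeroʳ (8 // 1 * (1ℚ - ε * ε)))) (0<-decide (5 // 1))
  ... | no not-ok | yes 0<s = ⊥-elim (<-irrefl refl (≤-<-trans
        (root-open (inward s) (0≤inward 0≤s s≤1) (<-≤-trans (inward-inside 0<s s≤1 0<gap) within))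
        (gap-persists 0≤s s≤1 0<gap)))
    where
    s≤1 : s ≤ 1ℚ
    s≤1 = root-region-≤1 s 0≤s within
    0<gap : 0ℚ < gap s
    0<gap = p<q⇒0<q-p (≰⇒> not-ok)

  weight≤twice-max : ∀ {x W} → 0ℚ < x → 0ℚ < W → W * W ≤ x * (2 // 1 * x + ε * W) → W ≤ 2 // 1 * x
  weight≤twice-max {x} {W} 0<x 0<W W²≤ with W ≤? 2 // 1 * x
  ... | yes W≤2x = W≤2x
  ... | no W≰2x = ⊥-elim (<-irrefl refl (≤-<-trans W²≤ (<-by-difference _ (identity x W ε)
        (pos+nonNeg (pos*pos (p<q⇒0<q-p (≰⇒> W≰2x))
            (pos+nonNeg (pos+nonNeg (pos*pos 0<W (0<-decide ½)) (<⇒≤ 0<x)) (0≤ε ⊛ <⇒≤ 0<W ⊛ 0≤-decide ½)))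
                    (<⇒≤ 0<W ⊛ <⇒≤ 0<W ⊛ 0≤1-ε ⊛ 0≤-decide ½)))))
    where
    identity : ∀ x W e → W * W - x * (2 // 1 * x + e * W)
                         ≡ (W - 2 // 1 * x) * (W * ½ + x + e * W * ½) + W * W * (1ℚ - e) * ½
    identity = solve 3 (λ x W e →
      W :* W :- x :* (con (2 // 1) :* x :+ e :* W)
      := (W :- con (2 // 1) :* x) :* (W :* con ½ :+ x :+ e :* W :* con ½)
         :+ W :* W :* (con 1ℚ :- e) :* con ½) refl

  helpful-bound : ∀ {x W p L} → 0ℚ < x → 0ℚ < W → 0ℚ ≤ p → W * W ≤ x * (2 // 1 * x + ε * W) →
                  (x - ε * W) * p ≤ x * L → 2 // 1 * ξ * p ≤ L
  helpful-bound {x} {W} 0<x 0<W 0≤p W²≤ = rate-bound (2 // 1 * ξ) (x - ε * W) 0<x 0≤p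
    (≤-by-difference _ (identity x W ε ξ)
      (<⇒≤ 0<x ⊛ p≤q⇒0≤q-p 2ξ≤1-2ε ⊕ 0≤ε ⊛ p≤q⇒0≤q-p (weight≤twice-max 0<x 0<W W²≤)))
    where
    identity : ∀ x W e k → x - e * W - 2 // 1 * k * x ≡ x * (1ℚ - 2 // 1 * e - 2 // 1 * k) + e *
        (2 // 1 * x - W)
    identity = solve 4 (λ x W e k →
      x :- e :* W :- con (2 // 1) :* k :* x
      := x :* (con 1ℚ :- con (2 // 1) :* e :- con (2 // 1) :* k) :+ e :* (con (2 // 1) :* x :- W)) refl

  special-bound : ∀ {x p L} → 0ℚ < x → 0ℚ ≤ p → x * (1 // 4) * p ≤ x * L → 2 // 1 * ξ * p ≤ L
  special-bound {x} 0<x 0≤p = rate-bound (2 // 1 * ξ) (x * (1 // 4)) 0<x 0≤p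
    (≤-by-difference _ (identity x ξ) (<⇒≤ 0<x ⊛
        (p≤q⇒0≤q-p 56ξ≤1 ⊛ 0≤-decide (1 // 4) ⊕ 0≤ξ ⊛ 0≤-decide (12 // 1))))
    where
    identity : ∀ x k → x * (1 // 4) - 2 // 1 * k * x ≡ x * ((1ℚ - 56 // 1 * k) * (1 // 4) + k * (12 // 1))
    identity = solve 2 (λ x k →
      x :* con (1 // 4) :- con (2 // 1) :* k :* x
      := x :* ((con 1ℚ :- con (56 // 1) :* k) :* con (1 // 4) :+ k :* con (12 // 1))) refl

  0<2+ε : 0ℚ < 2 // 1 + ε
  0<2+ε = pos+nonNeg (0<-decide (2 // 1)) 0≤ε

  large-neighbourhood-bound : ∀ {W S L} → 0ℚ ≤ S → (2 // 1 + ε) * W ≤ S → S - 2 // 1 * W ≤ L → 2 // 1 * ξ *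
      S ≤ L
  large-neighbourhood-bound {W} {S} {L} 0≤S [2+ε]W≤S S-2W≤L = *-cancelˡ-≤ 0<2+ε
    (≤-by-difference _ (identity S W L ε ξ)
      (<⇒≤ 0<2+ε ⊛ p≤q⇒0≤q-p S-2W≤L ⊕ 0≤-decide (2 // 1) ⊛ p≤q⇒0≤q-p [2+ε]W≤S
       ⊕ 0≤S ⊛ p≤q⇒0≤q-p ξ-small ⊛ 0≤-decide ½ ⊕ 0≤S ⊛ 0≤ε ⊛ 0≤-decide ½))
    where
    identity : ∀ S W L e k → (2 // 1 + e) * L - (2 // 1 + e) * (2 // 1 * k * S)
                             ≡ (2 // 1 + e) * (L - (S - 2 // 1 * W)) + 2 // 1 * (S - (2 // 1 + e) * W)
                               + S * (e - k * (4 // 1 * (2 // 1 + e))) * ½ + S * e * ½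
    identity = solve 5 (λ S W L e k →
      (con (2 // 1) :+ e) :* L :- (con (2 // 1) :+ e) :* (con (2 // 1) :* k :* S)
      := (con (2 // 1) :+ e) :* (L :- (S :- con (2 // 1) :* W))
         :+ con (2 // 1) :* (S :- (con (2 // 1) :+ e) :* W)
         :+ S :* (e :- k :* (con (4 // 1) :* (con (2 // 1) :+ e))) :* con ½ :+ S :* e :* con ½) refl

  light-bound : ∀ {W p S L} → 0ℚ ≤ W → ε * W < p → S ≤ (2 // 1 + ε) * W → p * ½ ≤ L → 2 // 1 * ξ * S ≤ L
  light-bound {W} {p} {S} {L} 0≤W εW<p S≤[2+ε]W p/2≤L = ≤-by-difference _ (identity W p L S ε ξ)
    (p≤q⇒0≤q-p p/2≤L ⊕ 0≤-decide ½ ⊛ p≤q⇒0≤q-p (<⇒≤ εW<p) ⊕ 0≤-decide ½ ⊛ 0≤W ⊛ p≤q⇒0≤q-p ξ-small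
     ⊕ 0≤-decide (2 // 1) ⊛ 0≤ξ ⊛ p≤q⇒0≤q-p S≤[2+ε]W)
    where
    identity : ∀ W p L S e k → L - 2 // 1 * k * S
                               ≡ (L - p * ½) + ½ * (p - e * W) + ½ * W * (e - k * (4 // 1 * (2 // 1 + e)))
                                 + 2 // 1 * k * ((2 // 1 + e) * W - S)
    identity = solve 6 (λ W p L S e k →
      L :- con (2 // 1) :* k :* S
      := (L :- p :* con ½) :+ con ½ :* (p :- e :* W)
         :+ con ½ :* W :* (e :- k :* (con (4 // 1) :* (con (2 // 1) :+ e)))
         :+ con (2 // 1) :* k :* ((con (2 // 1) :+ e) :* W :- S)) refl

  far-bound : ∀ {x r S L} → 0ℚ ≤ r → x ≤ 2 // 1 * r → S ≤ x + r → ε * r ≤ (1ℚ + ε) * L → 2 // 1 * ξ * S ≤ L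
  far-bound {x} {r} {S} {L} 0≤r x≤2r S≤x+r εr≤[1+ε]L = *-cancelˡ-≤ 0<1+ε
    (≤-by-difference _ (identity x r L S ε ξ)
      (p≤q⇒0≤q-p εr≤[1+ε]L ⊕ 0≤r ⊛ p≤q⇒0≤q-p ξ-small ⊕ 0≤-decide (2 // 1) ⊛ 0≤ξ ⊛ 0≤r ⊛ 0≤1-ε
       ⊕ 0≤-decide (2 // 1) ⊛ 0≤ξ ⊛ <⇒≤ 0<1+ε ⊛ p≤q⇒0≤q-p S≤x+r
       ⊕ 0≤-decide (2 // 1) ⊛ 0≤ξ ⊛ <⇒≤ 0<1+ε ⊛ p≤q⇒0≤q-p x≤2r))
    where
    identity : ∀ x r L S e k → (1ℚ + e) * L - (1ℚ + e) * (2 // 1 * k * S)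
                               ≡ ((1ℚ + e) * L - e * r) + r * (e - k * (4 // 1 * (2 // 1 + e)))
                                 + 2 // 1 * k * r * (1ℚ - e) + 2 // 1 * k * (1ℚ + e) * (x + r - S)
                                 + 2 // 1 * k * (1ℚ + e) * (2 // 1 * r - x)
    identity = solve 6 (λ x r L S e k →
      (con 1ℚ :+ e) :* L :- (con 1ℚ :+ e) :* (con (2 // 1) :* k :* S)
      := ((con 1ℚ :+ e) :* L :- e :* r) :+ r :* (e :- k :* (con (4 // 1) :* (con (2 // 1) :+ e)))
         :+ con (2 // 1) :* k :* r :* (con 1ℚ :- e)
         :+ con (2 // 1) :* k :* (con 1ℚ :+ e) :* (x :+ r :- S)
         :+ con (2 // 1) :* k :* (con 1ℚ :+ e) :* (con (2 // 1) :* r :- x)) refl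

  twin-bounded : ∀ {x z W S} → x + z ≤ S → S ≤ (2 // 1 + ε) * W → x ≤ (1ℚ + ε) * z → x ≤ (1ℚ + ε) * W
  twin-bounded {x} {z} {W} {S} x+z≤S S≤[2+ε]W x≤[1+ε]z = 0≤q-p⇒p≤q (nonNeg-factor 0<2+ε
    (nonNeg-by _ (identity x z W S ε)
      (<⇒≤ 0<1+ε ⊛ p≤q⇒0≤q-p S≤[2+ε]W ⊕ <⇒≤ 0<1+ε ⊛ p≤q⇒0≤q-p x+z≤S ⊕ p≤q⇒0≤q-p x≤[1+ε]z)))
    where
    identity : ∀ x z W S e → ((1ℚ + e) * W - x) * (2 // 1 + e)
                             ≡ (1ℚ + e) * ((2 // 1 + e) * W - S) + (1ℚ + e) * (S - (x + z)) + ((1ℚ + e) * z - x)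
    identity = solve 5 (λ x z W S e →
      ((con 1ℚ :+ e) :* W :- x) :* (con (2 // 1) :+ e)
      := (con 1ℚ :+ e) :* ((con (2 // 1) :+ e) :* W :- S) :+ (con 1ℚ :+ e) :* (S :- (x :+ z))
         :+ ((con 1ℚ :+ e) :* z :- x)) refl

  root-bound : ∀ {x W} → 0ℚ < x → 0ℚ ≤ W → 8 // 1 * (1ℚ - ε * ε) * (W * W) ≤ 5 // 1 * (x * x) →
               2 // 1 * ξ * x * (x + ε * W) ≤ (x - W) * (x - W)
  root-bound {x} {W} 0<x 0≤W within =
    subst (λ t → 2 // 1 * ξ * x * (x + ε * t) ≤ (x - t) * (x - t)) sx≡W
      (≤-by-difference _ (scale x s ε ξ) (<⇒≤ 0<x ⊛ <⇒≤ 0<x ⊛ p≤q⇒0≤q-p (root-closed s 0≤s s-within)))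
    where
    s : ℚ
    s = W /' x
    sx≡W : s * x ≡ W
    sx≡W = /'-inverse W 0<x
    0≤s : 0ℚ ≤ s
    0≤s = nonNeg-factor 0<x (subst (0ℚ ≤_) (sym sx≡W) 0≤W)
    0<x² : 0ℚ < x * x
    0<x² = pos*pos 0<x 0<x
    homogenise : ∀ x s d → x * x * (d * (s * s)) ≡ d * (s * x * (s * x))
    homogenise = solve 3 (λ x s d → x :* x :* (d :* (s :* s)) := d :* (s :* x :* (s :* x))) refl
    s-within : 8 // 1 * (1ℚ - ε * ε) * (s * s) ≤ 5 // 1
    s-within = *-cancelˡ-≤ 0<x²
      (subst₂ _≤_ (sym (homogenise x s (8 // 1 * (1ℚ - ε * ε)))) (*-comm (5 // 1) (x * x))
        (subst (λ t → 8 // 1 * (1ℚ - ε * ε) * (t * t) ≤ 5 // 1 * (x * x)) (sym sx≡W) within))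
    scale : ∀ x s e k → (x - s * x) * (x - s * x) - 2 // 1 * k * x * (x + e * (s * x))
                        ≡ x * x * ((1ℚ - s) * (1ℚ - s) - 2 // 1 * k * (1ℚ + e * s))
    scale = solve 4 (λ x s e k →
      (x :- s :* x) :* (x :- s :* x) :- con (2 // 1) :* k :* x :* (x :+ e :* (s :* x))
      := x :* x :* ((con 1ℚ :- s) :* (con 1ℚ :- s) :- con (2 // 1) :* k :* (con 1ℚ :+ e :* s))) refl

  isolated-bound : ∀ {x W r T S L} → 0ℚ < x → 0ℚ ≤ W → r ≤ ε * W → T ≤ ε * W * r →
                   W * W - T ≤ 5 // 8 * (x * x) → (x - W) * (x - W) ≤ x * L → S ≤ x + ε * W →
                   2 // 1 * ξ * S ≤ L
  isolated-bound {x} {W} {r} {T} {S} {L} 0<x 0≤W r≤εW T≤εWr W²-T≤ [x-W]²≤xL S≤x+εW = *-cancelˡ-≤ 0<x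
    (≤-by-difference _ (split x W L S ε ξ)
      (p≤q⇒0≤q-p [x-W]²≤xL ⊕ p≤q⇒0≤q-p (root-bound 0<x 0≤W within)
       ⊕ 0≤-decide (2 // 1) ⊛ 0≤ξ ⊛ <⇒≤ 0<x ⊛ p≤q⇒0≤q-p S≤x+εW))
    where
    weights : ∀ x W r T e → 5 // 1 * (x * x) - 8 // 1 * (1ℚ - e * e) * (W * W)
                            ≡ 8 // 1 * (5 // 8 * (x * x) - (W * W - T)) + 8 // 1 * (e * W * r - T)
                              + 8 // 1 * e * W * (e * W - r)
    weights = solve 5 (λ x W r T e →
      con (5 // 1) :* (x :* x) :- con (8 // 1) :* (con 1ℚ :- e :* e) :* (W :* W)
      := con (8 // 1) :* (con (5 // 8) :* (x :* x) :- (W :* W :- T))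
         :+ con (8 // 1) :* (e :* W :* r :- T) :+ con (8 // 1) :* e :* W :* (e :* W :- r)) refl
    within : 8 // 1 * (1ℚ - ε * ε) * (W * W) ≤ 5 // 1 * (x * x)
    within = ≤-by-difference _ (weights x W r T ε)
      (0≤-decide (8 // 1) ⊛ p≤q⇒0≤q-p W²-T≤ ⊕ 0≤-decide (8 // 1) ⊛ p≤q⇒0≤q-p T≤εWr
       ⊕ 0≤-decide (8 // 1) ⊛ 0≤ε ⊛ 0≤W ⊛ p≤q⇒0≤q-p r≤εW)
    split : ∀ x W L S e k → x * L - x * (2 // 1 * k * S)
                            ≡ (x * L - (x - W) * (x - W)) + ((x - W) * (x - W) - 2 // 1 * k * x * (x + e * W))
                              + 2 // 1 * k * x * (x + e * W - S)
    split = solve 6 (λ x W L S e k →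
      x :* L :- x :* (con (2 // 1) :* k :* S)
      := (x :* L :- (x :- W) :* (x :- W))
         :+ ((x :- W) :* (x :- W) :- con (2 // 1) :* k :* x :* (x :+ e :* W))
         :+ con (2 // 1) :* k :* x :* (x :+ e :* W :- S)) refl

  -- With t = W − (7/8)x − (7/15)z ≥ 0, x·L − 2ξ·x·S is a sum of nonnegative products of slacks.
  twin-bound : ∀ {x W y z S L} → 0ℚ < x → 0ℚ ≤ W → 0ℚ ≤ y → x * ½ ≤ z → z ≤ x → x ≤ (1ℚ + ε) * y →
               x + y + z ≤ S → S ≤ (2 // 1 + ε) * W → (x - W) * (x - W) + z * (x - z) ≤ x * L →
               2 // 1 * ξ * S ≤ L
  twin-bound {x} {W} {y} {z} {S} {L} 0<x 0≤W 0≤y x/2≤z z≤x x≤[1+ε]y x+y+z≤S S≤[2+ε]W gap≤xL = *-cancelˡ-≤ 0<x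
    (≤-by-difference _ (certificate x z W L S ε ξ)
      (p≤q⇒0≤q-p gap≤xL ⊕ 0≤t ⊛ 0≤t
       ⊕ 0≤t ⊛ (0≤-decide (14 // 15) ⊛ 0≤z-x/2 ⊕ 0≤-decide (61 // 420) ⊛ 0≤x)
       ⊕ 0≤-decide (176 // 225) ⊛ (0≤z-x/2 ⊛ p≤q⇒0≤q-p z≤x) ⊕ 0≤-decide (301 // 7200) ⊛ (0≤x ⊛ 0≤z-x/2)
       ⊕ 0≤-decide (2629 // 7200) ⊛ (0≤x ⊛ p≤q⇒0≤q-p z≤x)
       ⊕ 0≤x ⊛ 0≤W ⊛ p≤q⇒0≤q-p 7ε≤1 ⊛ 0≤-decide (1 // 14) ⊕ 0≤x ⊛ 0≤W ⊛ 0≤-decide ½ ⊛ p≤q⇒0≤q-p ξ-small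
       ⊕ 0≤x ⊛ (0≤-decide (2 // 1) ⊛ 0≤ξ) ⊛ p≤q⇒0≤q-p S≤[2+ε]W))
    where
    0≤x : 0ℚ ≤ x
    0≤x = <⇒≤ 0<x
    0≤z-x/2 : 0ℚ ≤ z - x * ½
    0≤z-x/2 = p≤q⇒0≤q-p x/2≤z
    0≤8y-7x : 0ℚ ≤ 8 // 1 * y - 7 // 1 * x
    0≤8y-7x = nonNeg-by _ (identity x y ε) (0≤y ⊛ p≤q⇒0≤q-p 7ε≤1 ⊕ 0≤-decide (7 // 1) ⊛ p≤q⇒0≤q-p x≤[1+ε]y)
      where
      identity : ∀ x y e → 8 // 1 * y - 7 // 1 * x ≡ y * (1ℚ - 7 // 1 * e) + 7 // 1 * ((1ℚ + e) * y - x)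
      identity = solve 3 (λ x y e →
        con (8 // 1) :* y :- con (7 // 1) :* x
        := y :* (con 1ℚ :- con (7 // 1) :* e) :+ con (7 // 1) :* ((con 1ℚ :+ e) :* y :- x)) refl
    0≤t : 0ℚ ≤ W - (7 // 8 * x + 7 // 15 * z)
    0≤t = nonNeg-by _ (identity x y z W S ε)
      (0≤-decide (7 // 15) ⊛ (0≤W ⊛ p≤q⇒0≤q-p 7ε≤1 ⊛ 0≤-decide (1 // 7) ⊕ p≤q⇒0≤q-p S≤[2+ε]W
                              ⊕ p≤q⇒0≤q-p x+y+z≤S ⊕ 0≤8y-7x ⊛ 0≤-decide (1 // 8)))
      where
      identity : ∀ x y z W S e → W - (7 // 8 * x + 7 // 15 * z)
                                 ≡ 7 // 15 * (W * (1ℚ - 7 // 1 * e) * (1 // 7) + ((2 // 1 + e) * W - S)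
                                              + (S - (x + y + z)) + (8 // 1 * y - 7 // 1 * x) * (1 // 8))
      identity = solve 6 (λ x y z W S e →
        W :- (con (7 // 8) :* x :+ con (7 // 15) :* z)
        := con (7 // 15) :* (W :* (con 1ℚ :- con (7 // 1) :* e) :* con (1 // 7) :+
            ((con (2 // 1) :+ e) :* W :- S) :+ (S :- (x :+ y :+ z)) :+
                (con (8 // 1) :* y :- con (7 // 1) :* x) :* con (1 // 8))) refl
    certificate : ∀ x z W L S e k →
      x * L - x * (2 // 1 * k * S)
      ≡ (x * L - ((x - W) * (x - W) + z * (x - z)))
        + (W - (7 // 8 * x + 7 // 15 * z)) * (W - (7 // 8 * x + 7 // 15 * z))
        + (W - (7 // 8 * x + 7 // 15 * z)) * (14 // 15 * (z - x * ½) + 61 // 420 * x)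
        + 176 // 225 * ((z - x * ½) * (x - z)) + 301 // 7200 * (x * (z - x * ½))
        + 2629 // 7200 * (x * (x - z))
        + x * W * (1ℚ - 7 // 1 * e) * (1 // 14) + x * W * ½ * (e - k * (4 // 1 * (2 // 1 + e)))
        + x * (2 // 1 * k) * ((2 // 1 + e) * W - S)
    certificate = solve 7 (λ x z W L S e k →
      x :* L :- x :* (con (2 // 1) :* k :* S)
      := (x :* L :- ((x :- W) :* (x :- W) :+ z :* (x :- z)))
         :+ (W :- (con (7 // 8) :* x :+ con (7 // 15) :* z)) :* (W :- (con (7 // 8) :* x :+ con (7 // 15) :* z))
         :+ (W :- (con (7 // 8) :* x :+ con (7 // 15) :* z)) :*
             (con (14 // 15) :* (z :- x :* con ½) :+ con (61 // 420) :* x)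
         :+ con (176 // 225) :* ((z :- x :* con ½) :* (x :- z))
         :+ con (301 // 7200) :* (x :* (z :- x :* con ½)) :+ con (2629 // 7200) :* (x :* (x :- z))
         :+ x :* W :* (con 1ℚ :- con (7 // 1) :* e) :* con (1 // 14)
         :+ x :* W :* con ½ :* (e :- k :* (con (4 // 1) :* (con (2 // 1) :+ e)))
         :+ x :* (con (2 // 1) :* k) :* ((con (2 // 1) :+ e) :* W :- S)) refl

module Neighbourhoods where
  open import Data.Bool using (Bool; true; false; T; _∧_)
  open import Data.Bool.Properties using (T-≡)
  open import Data.Fin using (Fin; zero; suc)
  open import Data.Fin.Subset using (Subset; _∈_; ⁅_⁆)
  open import Data.Fin.Subset.Properties using (x∈⁅x⁆; x∈⁅y⁆⇒x≡y)
  open import Data.Nat using (ℕ)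
  open import Data.Product using (∃; _×_; _,_)
  open import Data.Sum using (_⊎_; inj₁; inj₂)
  open import Data.Vec using (lookup)
  open import Function.Bundles using (Equivalence)
  open import Relation.Binary.PropositionalEquality using (_≡_; refl; subst)
  open import Defs using (Graph; Nb; anyᵛ)
  open Equivalence using (to; from)
  open Subsets

  anyᵛ-witness : ∀ {m} (f : Fin m → Bool) → T (anyᵛ f) → ∃ λ x → T (f x)
  anyᵛ-witness {ℕ.suc m} f t with f zero in eq
  ... | true = zero , from T-≡ eq
  ... | false with anyᵛ-witness (λ i → f (suc i)) t
  ...   | x , fx = suc x , fx

  anyᵛ-intro : ∀ {m} (f : Fin m → Bool) x → T (f x) → T (anyᵛ f)
  anyᵛ-intro f zero fx = T-∨⁺ˡ (f zero) fx
  anyᵛ-intro {ℕ.suc m} f (suc x) fx = T-∨⁺ʳ (f zero) (anyᵛ-intro (λ i → f (suc i)) x fx)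

  module _ {n} (G : Graph n) where
    open Graph G

    ∈Nb⁅⁆⁻ : ∀ {X : Subset n} {v a} → a ∈ Nb G ⁅ v ⁆ X → a ∈ X × (a ≡ v ⊎ adj a v ≡ true)
    ∈Nb⁅⁆⁻ {X} {v} {a} a∈ with T-∧⁻ (lookup X a) (∈-tabulate⁻ a∈)
    ... | a∈X , near with T-∨⁻ (lookup ⁅ v ⁆ a) near
    ...   | inj₁ a∈⁅v⁆ = T⇒∈ a∈X , inj₁ (x∈⁅y⁆⇒x≡y v (T⇒∈ a∈⁅v⁆))
    ...   | inj₂ some with anyᵛ-witness (λ x → lookup ⁅ v ⁆ x ∧ adj a x) some
    ...     | x , x-adj with T-∧⁻ (lookup ⁅ v ⁆ x) x-adj
    ...       | x∈⁅v⁆ , adj-a-x =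
                T⇒∈ a∈X , inj₂ (subst (λ y → adj a y ≡ true) (x∈⁅y⁆⇒x≡y v (T⇒∈ x∈⁅v⁆)) (to T-≡ adj-a-x))

    ∈Nb⁅⁆⁺ : ∀ {X : Subset n} {v a} → a ∈ X → a ≡ v ⊎ adj a v ≡ true → a ∈ Nb G ⁅ v ⁆ X
    ∈Nb⁅⁆⁺ {X} {v} a∈X (inj₁ refl) = ∈-tabulate⁺
        (T-∧⁺ (lookup X v) (∈⇒T a∈X) (T-∨⁺ˡ (lookup ⁅ v ⁆ v) (∈⇒T (x∈⁅x⁆ v))))
    ∈Nb⁅⁆⁺ {X} {v} {a} a∈X (inj₂ adj-a-v) = ∈-tabulate⁺ (T-∧⁺ (lookup X a) (∈⇒T a∈X) (T-∨⁺ʳ (lookup ⁅ v ⁆ a)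
      (anyᵛ-intro (λ x → lookup ⁅ v ⁆ x ∧ adj a x) v
          (T-∧⁺ (lookup ⁅ v ⁆ v) (∈⇒T (x∈⁅x⁆ v)) (from T-≡ adj-a-v)))))

module FixedVertex {n} (G : Graph n) (w : Fin n → ℚ) (w-pos : ∀ v → 0ℚ < w v)
    (A A* : Subset n) (A-independent : Independent G A) (no-improvement : NoClawShapedImprovement G w A)
    (nA n2A : Fin n → Fin n) (nA-max : IsChoiceN G w A nA) (n2A-max : IsChoiceN₂ G w A nA n2A)
    {ε ξ : ℚ} (bounds : ConstantBounds.Bounds ε ξ) (u : Fin n) where
  open import Data.Bool using (true; T; not; _∧_; _∨_; if_then_else_)
  open import Data.Empty using (⊥-elim)
  open import Data.Fin using (_≟_)
  open import Data.Fin.Subset using (_∈_; _∉_; _⊆_; ⁅_⁆; ∁; Empty; ∣_∣)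
  open import Data.Fin.Subset.Properties using (_∈?_; x∈⁅y⁆⇒x≡y; ∣⁅x⁆∣≡1; x∈∁p⇒x∉p; x∉p⇒x∈∁p)
  open import Data.Nat as ℕ using ()
  open import Data.Product using (_×_; _,_; proj₁; proj₂)
  open import Data.Rational using (1ℚ; ½; _+_; _-_; _*_; _≤_; _⊔_)
  open import Data.Rational.Properties
    using (_≤?_; _<?_; <-irrefl; ≤-refl; ≤-trans; ≤-reflexive; <⇒≤; ≮⇒≥; ≰⇒>; *-comm; ⊔-lub; p≤p⊔q; p≤q⊔p;
           +-identityˡ; +-identityʳ; +-monoʳ-≤; +-monoˡ-≤; +-mono-≤; <-≤-trans)
  open import Data.Sum using (_⊎_; inj₁; inj₂; [_,_])
  open import Data.Vec using (lookup)
  open import Relation.Binary.PropositionalEquality using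
      (_≡_; _≢_; refl; sym; trans; cong; cong₂; subst; subst₂)
  open import Relation.Nullary using (¬_; Dec; yes; no; contradiction)
  open import Relation.Nullary.Decidable using (⌊_⌋; fromWitness; toWitness)
  open import Data.Rational.Solver using (module +-*-Solver)
  open +-*-Solver using (solve; _:=_; con; _:+_; _:-_; _:*_)
  open import Defs using (module Setup; Nb; wt; wt²; _//_; _/'_; sq)
  open Graph G using (adj; irrefl) renaming (sym to adj-sym)
  open Setup G w A A* nA n2A ε
  open OrderedField
  open Subsets
  open Sums
  open Neighbourhoods
  open ExcessBounds
  open ConstantBounds.Bounds bounds
  open Consequences bounds

  N N₁ N₂ : Subset n
  N = NA u
  N₁ = N ∖ʳ nA u
  N₂ = N₁ ∖ʳ n2A u

  n₁ n₂ : Fin n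
  n₁ = nA u
  n₂ = n2A u

  x W : ℚ
  x = w n₁
  W = w u

  c : Fin n → ℚ
  c = contr u

  L : ℚ
  L = sumContr u - 2 // 1 * charge u n₁

  φ : Fin n → ℚ
  φ i = excess x (w i) (c i)

  0≤w : ∀ i → 0ℚ ≤ w i
  0≤w i = <⇒≤ (w-pos i)

  ∈N⁻ : ∀ {i} → i ∈ N → i ∈ A × (i ≡ u ⊎ adj i u ≡ true)
  ∈N⁻ = ∈Nb⁅⁆⁻ G {A} {u}

  N⊆A : N ⊆ A
  N⊆A i∈N = proj₁ (∈N⁻ i∈N)

  adjacent-if-u∉A : u ∉ A → ∀ {i} → i ∈ N → adj i u ≡ true
  adjacent-if-u∉A u∉A i∈N with ∈N⁻ i∈N
  ... | i∈A , inj₁ refl = contradiction i∈A u∉A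
  ... | _ , inj₂ adj-i-u = adj-i-u

  N⊆⁅u⁆-if-u∈A : u ∈ A → ∀ {i} → i ∈ N → i ≡ u
  N⊆⁅u⁆-if-u∈A u∈A i∈N with ∈N⁻ i∈N
  ... | _ , inj₁ i≡u = i≡u
  ... | i∈A , inj₂ adj-i-u with trans (sym adj-i-u) (A-independent _ _ i∈A u∈A)
  ...   | ()

  ⁅u⁆-independent : Independent G ⁅ u ⁆
  ⁅u⁆-independent a b a∈ b∈ rewrite x∈⁅y⁆⇒x≡y u a∈ | x∈⁅y⁆⇒x≡y u b∈ = irrefl u

  wt²⁅u⁆ : wt² w ⁅ u ⁆ ≡ W * W
  wt²⁅u⁆ = Σ∈-⁅⁆ u (λ i → sq (w i))

  N-nonEmpty : ¬ Empty N
  N-nonEmpty N-empty = no-improvement ⁅ u ⁆ (inj₁ (∣⁅x⁆∣≡1 u , N-empty))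
    (⁅u⁆-independent , subst₂ _<_ (sym (Σ∈-empty {X = N} λ i i∈N → N-empty (i , i∈N))) (sym wt²⁅u⁆)
                                  (pos*pos (w-pos u) (w-pos u)))

  n₁∈N : n₁ ∈ N
  n₁∈N = proj₁ (nA-max u N-nonEmpty)

  w≤x : ∀ {i} → i ∈ N → w i ≤ x
  w≤x {i} i∈N = proj₂ (nA-max u N-nonEmpty) i i∈N

  0<x : 0ℚ < x
  0<x = w-pos n₁

  N₁⊆N : N₁ ⊆ N
  N₁⊆N i∈N₁ = proj₁ (∈-∖⁻ N n₁ i∈N₁)

  W²≤wt²N : u ∉ A → W * W ≤ wt² w N
  W²≤wt²N u∉A = ≮⇒≥ λ wt²N<W² → no-improvement ⁅ u ⁆
    (inj₂ (n₁ , N⊆A n₁∈N , λ y y∈⁅u⁆ → subst (λ v → adj n₁ v ≡ true) (sym (x∈⁅y⁆⇒x≡y u y∈⁅u⁆))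
        (adjacent-if-u∉A u∉A n₁∈N)))
    (⁅u⁆-independent , subst (wt² w N <_) (sym wt²⁅u⁆) wt²N<W²)

  wtN≡x+wtN₁ : wt w N ≡ x + wt w N₁
  wtN≡x+wtN₁ = Σ∈-remove w n₁∈N

  wt²N≡x²+wt²N₁ : wt² w N ≡ x * x + wt² w N₁
  wt²N≡x²+wt²N₁ = Σ∈-remove (λ i → sq (w i)) n₁∈N

  contr≡ : ∀ {i} → i ∈ N → c i ≡ 0ℚ ⊔ ((sq W - wt² w (N ∖ʳ i)) /' w i)
  contr≡ i∈N = if-∈ i∈N

  contr-nonNeg : ∀ i → 0ℚ ≤ c i
  contr-nonNeg i with i ∈? N
  ... | yes i∈N = subst (0ℚ ≤_) (sym (contr≡ i∈N)) (p≤p⊔q 0ℚ ((sq W - wt² w (N ∖ʳ i)) /' w i))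
  ... | no i∉N = subst (0ℚ ≤_) (sym (if-∉ {X = N} i∉N)) ≤-refl

  contr-lower : ∀ {i} → i ∈ N → W * W - wt² w (N ∖ʳ i) ≤ w i * c i
  contr-lower {i} i∈N = subst (W * W - wt² w (N ∖ʳ i) ≤_) (*-comm (c i) (w i))
    (/'≤⇒≤* (w-pos i) (subst ((W * W - wt² w (N ∖ʳ i)) /' w i ≤_) (sym (contr≡ i∈N))
        (p≤q⊔p 0ℚ ((sq W - wt² w (N ∖ʳ i)) /' w i))))

  charge≡ : charge u n₁ ≡ W - ½ * wt w N
  charge≡ = if-true (fromWitness {a? = n₁ ≟ n₁} refl)
    where
    if-true : ∀ {b} {p q : ℚ} → T b → (if b then p else q) ≡ p
    if-true {true} _ = refl

  Φ : ℚ
  Φ = Σ∈ N₁ φ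

  Φ≡ : Φ ≡ x * wt w N₁ - wt² w N₁ + x * Σ∈ N₁ c
  Φ≡ = trans (Σ∈-+ N₁ (λ i → x * w i - w i * w i) (λ i → x * c i))
             (cong₂ _+_ (trans (Σ∈-- N₁ (λ i → x * w i) (λ i → w i * w i)) (cong (_- wt² w N₁) (Σ∈-* N₁ x w)))
                        (Σ∈-* N₁ x c))

  L≡ : L ≡ c n₁ + Σ∈ N₁ c - 2 // 1 * (W - ½ * (x + wt w N₁))
  L≡ = cong₂ (λ s t → s - 2 // 1 * t) (Σ∈-remove c n₁∈N) (trans charge≡ (cong (λ t → W - ½ * t) wtN≡x+wtN₁))

  charge-inequality : (x - W) * (x - W) + Φ ≤ x * L
  charge-inequality = subst₂ (λ p q → (x - W) * (x - W) + p ≤ x * q) (sym Φ≡) (sym L≡)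
    (≤-by-difference _ (identity x W (c n₁) (Σ∈ N₁ c) (wt w N₁) (wt² w N₁)) (p≤q⇒0≤q-p (contr-lower n₁∈N)))
    where
    identity : ∀ x W c₁ C R Q → x * (c₁ + C - 2 // 1 * (W - ½ * (x + R))) -
        ((x - W) * (x - W) + (x * R - Q + x * C))
                                ≡ x * c₁ - (W * W - Q)
    identity = solve 6 (λ x W c₁ C R Q →
      x :* (c₁ :+ C :- con (2 // 1) :* (W :- con ½ :* (x :+ R))) :-
          ((x :- W) :* (x :- W) :+ (x :* R :- Q :+ x :* C))
      := x :* c₁ :- (W :* W :- Q)) refl

  L≥wtN-2W : wt w N - 2 // 1 * W ≤ L
  L≥wtN-2W = subst (wt w N - 2 // 1 * W ≤_) (cong (λ t → sumContr u - 2 // 1 * t) (sym charge≡))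
    (≤-by-difference _ (identity (sumContr u) (wt w N) W) (Σ∈-nonNeg {X = N} λ {i} _ → contr-nonNeg i))
    where
    identity : ∀ s S W → s - 2 // 1 * (W - ½ * S) - (S - 2 // 1 * W) ≡ s
    identity = solve 3 (λ s S W →
      s :- con (2 // 1) :* (W :- con ½ :* S) :- (S :- con (2 // 1) :* W)
      := s) refl

  φ-nonNeg : ∀ {i} → i ∈ N₁ → 0ℚ ≤ φ i
  φ-nonNeg {i} i∈N₁ = excess-nonNeg (0≤w n₁) (0≤w i) (w≤x (N₁⊆N i∈N₁)) (contr-nonNeg i)

  Φ≤xL : Φ ≤ x * L
  Φ≤xL = ≤-trans (subst (_≤ (x - W) * (x - W) + Φ) (+-identityˡ Φ) (+-monoˡ-≤ Φ (square-nonNeg (x - W))))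
      charge-inequality

  excess-sum : ∀ {B} k → B ⊆ N₁ → (∀ {i} → i ∈ B → k * w i ≤ φ i) → k * wt w B ≤ x * L
  excess-sum {B} k B⊆N₁ k·w≤φ = ≤-trans (subst (_≤ Σ∈ B φ) (Σ∈-* B k w) (Σ∈-mono k·w≤φ))
                                        (≤-trans (Σ∈-⊆ B⊆N₁ φ-nonNeg) Φ≤xL)

  supp⁻ : ∀ {v} → v ∈ supp u → T (lookup N v) × T (not (lookup (help u) v) ∧ not (special u v))
  supp⁻ {v} v∈supp = T-∧⁻ (lookup N v) (∈-tabulate⁻ v∈supp)

  supp⊆N : supp u ⊆ N
  supp⊆N v∈supp = T⇒∈ (proj₁ (supp⁻ v∈supp))

  supp-excludes : ∀ {v} → v ∈ help u ⊎ T (special u v) → v ∉ supp u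
  supp-excludes {v} excluded v∈supp = [ T-not⇒∉ (proj₁ unmarked) , T-not⇒¬T (proj₂ unmarked) ] excluded
    where
    unmarked : T (not (lookup (help u) v)) × T (not (special u v))
    unmarked = T-∧⁻ (not (lookup (help u) v)) (proj₂ (supp⁻ v∈supp))

  helpful-parts : ∀ {v} → v ∈ help u → T (lookup (Nb G ⁅ v ⁆ (∁ A)) u) × T (helpfulA u v ∨ helpfulB u v)
  helpful-parts {v} v∈help = T-∧⁻ (lookup (Nb G ⁅ v ⁆ (∁ A)) u) (proj₂ (T-∧⁻ (lookup A v) (∈-tabulate⁻ v∈help)))

  help⇒u∉A : ∀ {v} → v ∈ help u → u ∉ A
  help⇒u∉A {v} v∈help = x∈∁p⇒x∉p (proj₁ (∈Nb⁅⁆⁻ G {∁ A} {v} (T⇒∈ (proj₁ (helpful-parts v∈help)))))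

  help⇒kind : ∀ {v} → v ∈ help u → T (helpfulA u v) ⊎ T (helpfulB u v)
  help⇒kind {v} v∈help = T-∨⁻ (helpfulA u v) (proj₂ (helpful-parts v∈help))

  help-intro : ∀ {v} → v ∈ N → u ∉ A → T (helpfulB u v) → v ∈ help u
  help-intro {v} v∈N u∉A helpfulB-uv =
    ∈-tabulate⁺ (T-∧⁺ (lookup A v) (∈⇒T (N⊆A v∈N))
                  (T-∧⁺ (lookup (Nb G ⁅ v ⁆ (∁ A)) u) (∈⇒T u∈Nb) (T-∨⁺ʳ (helpfulA u v) helpfulB-uv)))
    where
    u∈Nb : u ∈ Nb G ⁅ v ⁆ (∁ A)
    u∈Nb = ∈Nb⁅⁆⁺ G (x∉p⇒x∈∁p u∉A) (inj₂ (trans (adj-sym u v) (adjacent-if-u∉A u∉A v∈N)))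

  helpfulA⇒wtN₁≤εW : ∀ {v} → T (helpfulA u v) → wt w N₁ ≤ ε * W
  helpfulA⇒wtN₁≤εW {v} h = toWitness (proj₂ (T-∧⁻ (⌊≤⌋ x ((1ℚ + ε) * W)) (proj₂ (T-∧⁻ (⌊≡⌋ v n₁) h))))

  helpfulB⇒2≤∣N∣ : ∀ {v} → T (helpfulB u v) → 2 ℕ.≤ ∣ N ∣
  helpfulB⇒2≤∣N∣ h = toWitness (proj₁ (T-∧⁻ ⌊ 2 ℕ.≤? ∣ N ∣ ⌋ h))

  helpfulB⇒wtN₂≤εW : ∀ {v} → T (helpfulB u v) → wt w N₂ ≤ ε * W
  helpfulB⇒wtN₂≤εW {v} h =
    toWitness (proj₂ (T-∧⁻ (⌊≤⌋ x ((1ℚ + ε) * W)) (proj₂ (T-∧⁻ (⌊≤⌋ (w n₂) x)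
      (proj₂ (T-∧⁻ (⌊≤⌋ ((1ℚ /' (1ℚ + ε)) * x) (w n₂)) (proj₂ (T-∧⁻ (⌊≡⌋ v n₁ ∨ ⌊≡⌋ v n₂)
        (proj₂ (T-∧⁻ ⌊ 2 ℕ.≤? ∣ N ∣ ⌋ h))))))))))

  0≤2ξ : 0ℚ ≤ 2 // 1 * ξ
  0≤2ξ = 0≤-decide (2 // 1) ⊛ 0≤ξ

  bound-supp : ∀ {B} → supp u ⊆ B → 2 // 1 * ξ * wt w B ≤ L → 2 // 1 * ξ * wt w (supp u) ≤ L
  bound-supp supp⊆B = ≤-trans (*-monoˡ-≤ 0≤2ξ (Σ∈-⊆ supp⊆B λ {i} _ → 0≤w i))

  wt²N≤x·wtN : wt² w N ≤ x * wt w N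
  wt²N≤x·wtN = subst (wt² w N ≤_) (Σ∈-* N x w)
    (Σ∈-mono λ {i} i∈N → *-monoʳ-≤ (0≤w i) (w≤x i∈N))

  W²≤x[2x+εW] : u ∉ A → wt w N ≤ 2 // 1 * x + ε * W → W * W ≤ x * (2 // 1 * x + ε * W)
  W²≤x[2x+εW] u∉A wtN≤ = ≤-trans (W²≤wt²N u∉A) (≤-trans wt²N≤x·wtN (*-monoˡ-≤ (0≤w n₁) wtN≤))

  wtN≤2x+ : ∀ {q} → wt w N₁ ≤ x + q → wt w N ≤ 2 // 1 * x + q
  wtN≤2x+ {q} wtN₁≤x+q = subst (_≤ 2 // 1 * x + q) (sym wtN≡x+wtN₁)
    (≤-by-difference _ (identity x (wt w N₁) q) (p≤q⇒0≤q-p wtN₁≤x+q))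
    where
    identity : ∀ x p q → 2 // 1 * x + q - (x + p) ≡ x + q - p
    identity = solve 3 (λ x p q → con (2 // 1) :* x :+ q :- (x :+ p) := x :+ q :- p) refl

  light-excess : ∀ {B} m → B ⊆ N₁ → wt w B ≤ m → ∀ {i} → i ∈ B → (x - m) * w i ≤ φ i
  light-excess m B⊆N₁ wtB≤m {i} i∈B =
    excess-≥-light m (0≤w n₁) (0≤w i) (≤-trans (term≤Σ∈ w i∈B λ {j} _ → 0≤w j) wtB≤m) (contr-nonNeg i)

  n₂-max : 2 ℕ.≤ ∣ N ∣ → n₂ ∈ N₁ × (∀ {i} → i ∈ N₁ → w i ≤ w n₂)
  n₂-max 2≤∣N∣ = ∈-∖⁺ (proj₁ choice) (proj₁ (proj₂ choice)) ,
                 λ {i} i∈N₁ → proj₂ (proj₂ choice) i (proj₁ (∈-∖⁻ N n₁ i∈N₁)) (proj₂ (∈-∖⁻ N n₁ i∈N₁))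
    where
    choice : n₂ ∈ N × n₂ ≢ n₁ × (∀ a → a ∈ N → a ≢ n₁ → w a ≤ w n₂)
    choice = n2A-max u 2≤∣N∣

  wtN₁≡ : n₂ ∈ N₁ → wt w N₁ ≡ w n₂ + wt w N₂
  wtN₁≡ n₂∈N₁ = Σ∈-remove w n₂∈N₁

  helpfulB-n₂ : T (helpfulB u n₁) → T (helpfulB u n₂)
  helpfulB-n₂ h = T-∧⁺ ⌊ 2 ℕ.≤? ∣ N ∣ ⌋ (proj₁ (T-∧⁻ ⌊ 2 ℕ.≤? ∣ N ∣ ⌋ h))
                    (T-∧⁺ (⌊≡⌋ n₂ n₁ ∨ ⌊≡⌋ n₂ n₂) (T-∨⁺ʳ (⌊≡⌋ n₂ n₁) (fromWitness refl))
                          (proj₂ (T-∧⁻ (⌊≡⌋ n₁ n₁ ∨ ⌊≡⌋ n₁ n₂) (proj₂ (T-∧⁻ ⌊ 2 ℕ.≤? ∣ N ∣ ⌋ h)))))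

  helpfulA-case : u ∉ A → n₁ ∈ help u → T (helpfulA u n₁) → 2 // 1 * ξ * wt w (supp u) ≤ L
  helpfulA-case u∉A n₁-helpful kindA =
    bound-supp (⊆-∖ supp⊆N (supp-excludes (inj₁ n₁-helpful)))
      (helpful-bound 0<x (w-pos u) (Σ∈-nonNeg {X = N₁} λ {i} _ → 0≤w i)
        (W²≤x[2x+εW] u∉A (wtN≤2x+ (≤-trans wtN₁≤εW εW≤x+εW)))
        (excess-sum (x - ε * W) (λ i∈ → i∈) (light-excess (ε * W) (λ i∈ → i∈) wtN₁≤εW)))
    where
    wtN₁≤εW : wt w N₁ ≤ ε * W
    wtN₁≤εW = helpfulA⇒wtN₁≤εW {n₁} kindA
    εW≤x+εW : ε * W ≤ x + ε * W
    εW≤x+εW = subst (_≤ x + ε * W) (+-identityˡ (ε * W)) (+-monoˡ-≤ (ε * W) (0≤w n₁))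

  helpfulB-case : u ∉ A → n₁ ∈ help u → T (helpfulB u n₁) → 2 // 1 * ξ * wt w (supp u) ≤ L
  helpfulB-case u∉A n₁-helpful kindB =
    bound-supp (⊆-∖ (⊆-∖ supp⊆N (supp-excludes (inj₁ n₁-helpful))) (supp-excludes (inj₁ n₂-helpful)))
      (helpful-bound 0<x (w-pos u) (Σ∈-nonNeg {X = N₂} λ {i} _ → 0≤w i)
        (W²≤x[2x+εW] u∉A (wtN≤2x+ (subst (_≤ x + ε * W) (sym (wtN₁≡ n₂∈N₁))
            (+-mono-≤ (w≤x (N₁⊆N n₂∈N₁)) wtN₂≤εW))))
        (excess-sum (x - ε * W) N₂⊆N₁ (light-excess (ε * W) N₂⊆N₁ wtN₂≤εW)))
    where
    wtN₂≤εW : wt w N₂ ≤ ε * W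
    wtN₂≤εW = helpfulB⇒wtN₂≤εW {n₁} kindB
    n₂∈N₁ : n₂ ∈ N₁
    n₂∈N₁ = proj₁ (n₂-max (helpfulB⇒2≤∣N∣ {n₁} kindB))
    N₂⊆N₁ : N₂ ⊆ N₁
    N₂⊆N₁ i∈N₂ = proj₁ (∈-∖⁻ N₁ n₂ i∈N₂)
    n₂-helpful : n₂ ∈ help u
    n₂-helpful = help-intro (N₁⊆N n₂∈N₁) u∉A (helpfulB-n₂ kindB)

  helpful-case : n₁ ∈ help u → 2 // 1 * ξ * wt w (supp u) ≤ L
  helpful-case n₁-helpful =
    [ helpfulA-case u∉A n₁-helpful , helpfulB-case u∉A n₁-helpful ] (help⇒kind n₁-helpful)
    where
    u∉A : u ∉ A
    u∉A = help⇒u∉A n₁-helpful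

  wt²-without : ∀ {i} → i ∈ N → W * W - wt² w (N ∖ʳ i) ≡ w i * w i - (wt² w N - W * W)
  wt²-without {i} i∈N = trans (identity W (w i) (wt² w (N ∖ʳ i)))
                            (cong (λ t → w i * w i - (t - W * W)) (sym (Σ∈-remove (λ j → sq (w j)) i∈N)))
    where
    identity : ∀ W y R → W * W - R ≡ y * y - (y * y + R - W * W)
    identity = solve 3 (λ W y R → W :* W :- R := y :* y :- (y :* y :+ R :- W :* W)) refl

  special-case : u ∈ A* → n₁ ∉ help u → 5 // 8 * x < c n₁ → 2 // 1 * ξ * wt w (supp u) ≤ L
  special-case u∈A* n₁-unhelpful special-gap =
    bound-supp (⊆-∖ supp⊆N (supp-excludes (inj₂ n₁-special)))
      (special-bound 0<x (Σ∈-nonNeg {X = N₁} λ {i} _ → 0≤w i) (excess-sum (x * (1 // 4)) (λ i∈ → i∈) quarter))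
    where
    n₁-special : T (special u n₁)
    n₁-special = T-∧⁺ (lookup A* u) (∈⇒T u∈A*) (T-∧⁺ (lookup A n₁) (∈⇒T (N⊆A n₁∈N))
                   (T-∧⁺ (⌊≡⌋ n₁ n₁) (fromWitness refl) (T-∧⁺ (not (lookup (help u) n₁)) (∉⇒T-not n₁-unhelpful)
                     (fromWitness special-gap))))
    5/8x²<W²-Q : 5 // 8 * x * x < W * W - wt² w N₁
    5/8x²<W²-Q with (W * W - wt² w N₁) /' x ≤? 5 // 8 * x
    ... | yes small = ⊥-elim (<-irrefl refl (<-≤-trans special-gap
                        (subst (_≤ 5 // 8 * x) (sym (contr≡ n₁∈N))
                            (⊔-lub (0≤-decide (5 // 8) ⊛ 0≤w n₁) small))))
    ... | no large = </'⇒*< 0<x (≰⇒> large)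
    D-small : 8 // 1 * (wt² w N - W * W) < 3 // 1 * (x * x)
    D-small = subst (λ t → 8 // 1 * (t - W * W) < 3 // 1 * (x * x)) (sym wt²N≡x²+wt²N₁)
      (<-by-difference _ (identity x (wt² w N₁) W) (pos*pos (0<-decide (8 // 1)) (p<q⇒0<q-p 5/8x²<W²-Q)))
      where
      identity : ∀ x Q W → 3 // 1 * (x * x) - 8 // 1 * (x * x + Q - W * W) ≡ 8 // 1 *
          (W * W - Q - 5 // 8 * x * x)
      identity = solve 3 (λ x Q W →
        con (3 // 1) :* (x :* x) :- con (8 // 1) :* (x :* x :+ Q :- W :* W)
        := con (8 // 1) :* (W :* W :- Q :- con (5 // 8) :* x :* x)) refl
    quarter : ∀ {i} → i ∈ N₁ → x * (1 // 4) * w i ≤ φ i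
    quarter {i} i∈N₁ = excess-≥-quarter 0<x (w-pos i) (w≤x i∈N) (contr-nonNeg i)
                         (subst (_≤ w i * c i) (wt²-without i∈N) (contr-lower i∈N)) D-small
      where
      i∈N : i ∈ N
      i∈N = N₁⊆N i∈N₁

  u∈A⇒special : u ∈ A → 5 // 8 * x < c n₁
  u∈A⇒special u∈A = <-≤-trans 5/8x<x x≤c₁
    where
    n₁≡u : n₁ ≡ u
    n₁≡u = N⊆⁅u⁆-if-u∈A u∈A n₁∈N
    wt²N₁≡0 : wt² w N₁ ≡ 0ℚ
    wt²N₁≡0 = Σ∈-empty {X = N₁} λ i i∈N₁ →
      proj₂ (∈-∖⁻ N n₁ i∈N₁) (trans (N⊆⁅u⁆-if-u∈A u∈A (N₁⊆N i∈N₁)) (sym n₁≡u))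
    minus-zero : ∀ p → p - 0ℚ ≡ p
    minus-zero = solve 1 (λ p → p :- con 0ℚ := p) refl
    x≤c₁ : x ≤ c n₁
    x≤c₁ = *-cancelˡ-≤ 0<x (subst (_≤ x * c n₁)
             (trans (cong₂ (λ a b → a * a - b) (cong w (sym n₁≡u)) wt²N₁≡0) (minus-zero (x * x)))
             (contr-lower n₁∈N))
    5/8x<x : 5 // 8 * x < x
    5/8x<x = <-by-difference _ (identity x) (pos*pos (0<-decide (3 // 8)) 0<x)
      where
      identity : ∀ x → x - 5 // 8 * x ≡ 3 // 8 * x
      identity = solve 1 (λ x → x :- con (5 // 8) :* x := con (3 // 8) :* x) refl

  light-case : ∀ {B} → B ⊆ N₁ → (∀ {j} → j ∈ B → ¬ (x * ½ < w j)) → ε * W < wt w B →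
               wt w N ≤ (2 // 1 + ε) * W → 2 // 1 * ξ * wt w N ≤ L
  light-case {B} B⊆N₁ all-light εW<wtB wtN≤ = light-bound (0≤w u) εW<wtB wtN≤
    (*-cancelˡ-≤ 0<x (subst (_≤ x * L) (reassoc x (wt w B))
      (excess-sum (x * ½) B⊆N₁ λ {j} j∈B → excess-≥-half (0≤w n₁) (0≤w j) (≮⇒≥ (all-light j∈B))
          (contr-nonNeg j))))
    where
    reassoc : ∀ x p → x * ½ * p ≡ x * (p * ½)
    reassoc = solve 2 (λ x p → x :* con ½ :* p := x :* (p :* con ½)) refl

  far-case : (∀ {i} → i ∈ N₁ → ¬ (x ≤ (1ℚ + ε) * w i)) → ε * W < wt w N₁ →
             wt w N ≤ (2 // 1 + ε) * W → 2 // 1 * ξ * wt w N ≤ L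
  far-case all-far εW<R wtN≤ with some-or-none N₁ (λ j → x * ½ <? w j)
  ... | inj₂ all-light = light-case (λ i∈ → i∈) all-light εW<R wtN≤
  ... | inj₁ (j , j∈N₁ , x/2<wj) = far-bound 0≤R x≤2R (≤-reflexive wtN≡x+wtN₁) εR≤[1+ε]L
    where
    0≤R : 0ℚ ≤ wt w N₁
    0≤R = Σ∈-nonNeg {X = N₁} λ {i} _ → 0≤w i
    x≤2R : x ≤ 2 // 1 * wt w N₁
    x≤2R = ≤-by-difference _ (identity x (w j) (wt w N₁))
             (0≤-decide (2 // 1) ⊛ p≤q⇒0≤q-p (term≤Σ∈ w j∈N₁ λ {i} _ → 0≤w i)
              ⊕ 0≤-decide (2 // 1) ⊛ p≤q⇒0≤q-p (<⇒≤ x/2<wj))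
      where
      identity : ∀ x y R → 2 // 1 * R - x ≡ 2 // 1 * (R - y) + 2 // 1 * (y - x * ½)
      identity = solve 3 (λ x y R →
        con (2 // 1) :* R :- x
        := con (2 // 1) :* (R :- y) :+ con (2 // 1) :* (y :- x :* con ½)) refl
    εxR≤[1+ε]Φ : ε * x * wt w N₁ ≤ (1ℚ + ε) * Φ
    εxR≤[1+ε]Φ = subst₂ _≤_ (Σ∈-* N₁ (ε * x) w) (Σ∈-* N₁ (1ℚ + ε) φ)
      (Σ∈-mono λ {i} i∈N₁ → excess-≥-far ε 0≤ε (0≤w n₁) (0≤w i) (<⇒≤ (≰⇒> (all-far i∈N₁))) (contr-nonNeg i))
    εR≤[1+ε]L : ε * wt w N₁ ≤ (1ℚ + ε) * L
    εR≤[1+ε]L = *-cancelˡ-≤ 0<x (subst₂ _≤_ (reassoc₁ ε x (wt w N₁)) (reassoc₂ ε x L)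
                  (≤-trans εxR≤[1+ε]Φ (*-monoˡ-≤ (<⇒≤ 0<1+ε) Φ≤xL)))
      where
      reassoc₁ : ∀ e x R → e * x * R ≡ x * (e * R)
      reassoc₁ = solve 3 (λ e x R → e :* x :* R := x :* (e :* R)) refl
      reassoc₂ : ∀ e x L → (1ℚ + e) * (x * L) ≡ x * ((1ℚ + e) * L)
      reassoc₂ = solve 3 (λ e x L → (con 1ℚ :+ e) :* (x :* L) := x :* ((con 1ℚ :+ e) :* L)) refl

  helpfulB-intro : 2 ℕ.≤ ∣ N ∣ → (1ℚ /' (1ℚ + ε)) * x ≤ w n₂ → w n₂ ≤ x → x ≤ (1ℚ + ε) * W → wt w N₂ ≤ ε * W →
              T (helpfulB u n₁)
  helpfulB-intro 2≤∣N∣ x/[1+ε]≤x₂ x₂≤x x≤[1+ε]W wtN₂≤εW =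
    T-∧⁺ ⌊ 2 ℕ.≤? ∣ N ∣ ⌋ (fromWitness 2≤∣N∣)
        (T-∧⁺ (⌊≡⌋ n₁ n₁ ∨ ⌊≡⌋ n₁ n₂) (T-∨⁺ˡ (⌊≡⌋ n₁ n₁) (fromWitness refl))
      (T-∧⁺ (⌊≤⌋ ((1ℚ /' (1ℚ + ε)) * x) (w n₂)) (fromWitness x/[1+ε]≤x₂)
        (T-∧⁺ (⌊≤⌋ (w n₂) x) (fromWitness x₂≤x)
          (T-∧⁺ (⌊≤⌋ x ((1ℚ + ε) * W)) (fromWitness x≤[1+ε]W) (fromWitness wtN₂≤εW)))))

  twin-close : n₂ ∈ N₁ → x ≤ (1ℚ + ε) * w n₂ → ε * W < wt w N₂ → wt w N ≤ (2 // 1 + ε) * W →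
               2 // 1 * ξ * wt w N ≤ L
  twin-close n₂∈N₁ x≤[1+ε]x₂ εW<R₂ wtN≤ with some-or-none N₂ (λ j → x * ½ <? w j)
  ... | inj₂ all-light = light-case N₂⊆N₁ all-light εW<R₂ wtN≤
    where
    N₂⊆N₁ : N₂ ⊆ N₁
    N₂⊆N₁ i∈N₂ = proj₁ (∈-∖⁻ N₁ n₂ i∈N₂)
  ... | inj₁ (j , j∈N₂ , x/2<wj) = twin-bound 0<x (0≤w u) (0≤w n₂) (<⇒≤ x/2<wj) (w≤x (N₁⊆N j∈N₁)) x≤[1+ε]x₂
                                     x+x₂+wj≤wtN wtN≤ gap≤xL
    where
    j∈N₁ : j ∈ N₁
    j∈N₁ = proj₁ (∈-∖⁻ N₁ n₂ j∈N₂)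
    x+x₂+wj≤wtN : x + w n₂ + w j ≤ wt w N
    x+x₂+wj≤wtN = subst (x + w n₂ + w j ≤_) (sym (trans wtN≡x+wtN₁ (cong (x +_) (wtN₁≡ n₂∈N₁))))
      (≤-by-difference _ (identity x (w n₂) (w j) (wt w N₂)) (p≤q⇒0≤q-p (term≤Σ∈ w j∈N₂ λ {i} _ → 0≤w i)))
      where
      identity : ∀ x y z R → x + (y + R) - (x + y + z) ≡ R - z
      identity = solve 4 (λ x y z R → x :+ (y :+ R) :- (x :+ y :+ z) := R :- z) refl
    gap≤xL : (x - W) * (x - W) + w j * (x - w j) ≤ x * L
    gap≤xL = ≤-trans (+-monoʳ-≤ ((x - W) * (x - W))
               (≤-trans (excess-≥-gap (0≤w n₁) (contr-nonNeg j)) (term≤Σ∈ φ j∈N₁ φ-nonNeg)))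
             charge-inequality

  twin-case : ∀ {i₀} → i₀ ∈ N₁ → x ≤ (1ℚ + ε) * w i₀ → u ∉ A → n₁ ∉ help u →
              wt w N ≤ (2 // 1 + ε) * W → 2 // 1 * ξ * wt w N ≤ L
  twin-case {i₀} i₀∈N₁ x≤[1+ε]w₀ u∉A n₁-unhelpful wtN≤ = twin-close n₂∈N₁ x≤[1+ε]x₂ εW<R₂ wtN≤
    where
    2≤∣N∣ : 2 ℕ.≤ ∣ N ∣
    2≤∣N∣ = two-elements n₁∈N (N₁⊆N i₀∈N₁) (proj₂ (∈-∖⁻ N n₁ i₀∈N₁))
    n₂∈N₁ : n₂ ∈ N₁
    n₂∈N₁ = proj₁ (n₂-max 2≤∣N∣)
    x≤[1+ε]x₂ : x ≤ (1ℚ + ε) * w n₂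
    x≤[1+ε]x₂ = ≤-trans x≤[1+ε]w₀ (*-monoˡ-≤ (<⇒≤ 0<1+ε) (proj₂ (n₂-max 2≤∣N∣) i₀∈N₁))
    x+w₀≤wtN : x + w i₀ ≤ wt w N
    x+w₀≤wtN = subst (x + w i₀ ≤_) (sym wtN≡x+wtN₁) (+-monoʳ-≤ x (term≤Σ∈ w i₀∈N₁ λ {i} _ → 0≤w i))
    εW<R₂ : ε * W < wt w N₂
    εW<R₂ = ≰⇒> λ R₂≤εW → n₁-unhelpful (help-intro n₁∈N u∉A
              (helpfulB-intro 2≤∣N∣ (≤*⇒/'*≤ 0<1+ε x≤[1+ε]x₂) (w≤x (N₁⊆N n₂∈N₁))
                         (twin-bounded x+w₀≤wtN wtN≤ x≤[1+ε]w₀) R₂≤εW))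

  unhelpful-case : u ∉ A → n₁ ∉ help u → c n₁ ≤ 5 // 8 * x → 2 // 1 * ξ * wt w N ≤ L
  unhelpful-case u∉A n₁-unhelpful c₁-small with ≤-or-> ((2 // 1 + ε) * W) (wt w N)
  ... | inj₁ large = large-neighbourhood-bound (Σ∈-nonNeg {X = N} λ {i} _ → 0≤w i) large L≥wtN-2W
  ... | inj₂ small with ≤-or-> (wt w N₁) (ε * W)
  ...   | inj₁ R≤εW = isolated-bound 0<x (0≤w u) R≤εW Q≤εWR W²-Q≤ [x-W]²≤xL
                       (subst (_≤ x + ε * W) (sym wtN≡x+wtN₁) (+-monoʳ-≤ x R≤εW))
    where
    Q≤εWR : wt² w N₁ ≤ ε * W * wt w N₁
    Q≤εWR = subst (wt² w N₁ ≤_) (Σ∈-* N₁ (ε * W) w)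
      (Σ∈-mono {X = N₁} λ {i} i∈N₁ → *-monoʳ-≤ (0≤w i)
                               (≤-trans (term≤Σ∈ w i∈N₁ λ {j} _ → 0≤w j) R≤εW))
    W²-Q≤ : W * W - wt² w N₁ ≤ 5 // 8 * (x * x)
    W²-Q≤ = ≤-trans (contr-lower n₁∈N) (subst (x * c n₁ ≤_) (reassoc x) (*-monoˡ-≤ (0≤w n₁) c₁-small))
      where
      reassoc : ∀ x → x * (5 // 8 * x) ≡ 5 // 8 * (x * x)
      reassoc = solve 1 (λ x → x :* (con (5 // 8) :* x) := con (5 // 8) :* (x :* x)) refl
    [x-W]²≤xL : (x - W) * (x - W) ≤ x * L
    [x-W]²≤xL = ≤-trans (subst (_≤ (x - W) * (x - W) + Φ) (+-identityʳ ((x - W) * (x - W)))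
                          (+-monoʳ-≤ ((x - W) * (x - W)) (Σ∈-nonNeg {X = N₁} φ-nonNeg)))
                        charge-inequality
  ...   | inj₂ εW<R with some-or-none N₁ (λ i → x ≤? (1ℚ + ε) * w i)
  ...     | inj₁ (i₀ , i₀∈N₁ , close) = twin-case i₀∈N₁ close u∉A n₁-unhelpful (<⇒≤ small)
  ...     | inj₂ all-far = far-case all-far εW<R (<⇒≤ small)

  supp-weight-bound : u ∈ A* → 2 // 1 * ξ * wt w (supp u) ≤ L
  supp-weight-bound u∈A* = by-helpfulness (n₁ ∈? help u)
    where
    by-membership : n₁ ∉ help u → ¬ (5 // 8 * x < c n₁) → Dec (u ∈ A) → 2 // 1 * ξ * wt w (supp u) ≤ L
    by-membership _ no-gap (yes u∈A) = contradiction (u∈A⇒special u∈A) no-gap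
    by-membership n₁-unhelpful no-gap (no u∉A) = bound-supp supp⊆N
        (unhelpful-case u∉A n₁-unhelpful (≮⇒≥ no-gap))
    by-gap : n₁ ∉ help u → Dec (5 // 8 * x < c n₁) → 2 // 1 * ξ * wt w (supp u) ≤ L
    by-gap n₁-unhelpful (yes special-gap) = special-case u∈A* n₁-unhelpful special-gap
    by-gap n₁-unhelpful (no no-gap) = by-membership n₁-unhelpful no-gap (u ∈? A)
    by-helpfulness : Dec (n₁ ∈ help u) → 2 // 1 * ξ * wt w (supp u) ≤ L
    by-helpfulness (yes n₁-helpful) = helpful-case n₁-helpful
    by-helpfulness (no n₁-unhelpful) = by-gap n₁-unhelpful (5 // 8 * x <? c n₁)

open import Defs
open import Data.Nat using (ℕ; suc; _≤_)
open import Data.Fin.Subset using (_∈_)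
open import Data.Rational using (_*_; _-_) renaming (_≤_ to _≤ℚ_)

lemma4 : (k : ℕ) → 4 ≤ k →
    {n : ℕ} (G : Graph n) → ClawFree G ((suc k)) →
    (w : Fin n → ℚ) → (∀ v → 0ℚ < w v) →
    (ε ξ : ℚ) → Constants ε ξ →
    (A* A : Subset n) → MaxWeightIndep G w A* →
    Independent G A → NoClawShapedImprovement G w A →
    (nA n2A : Fin n → Fin n) → IsChoiceN G w A nA → IsChoiceN₂ G w A nA n2A →
    let open Setup G w A A* nA n2A ε in
    ∀ u → u ∈ A* →
    (2 // 1 * ξ) * wt w (supp u) ≤ℚ sumContr u - 2 // 1 * charge u (nA u)
lemma4 _ _ G _ w w-pos ε ξ constants A* A _ A-independent no-improvement nA n2A nA-max n2A-max u u∈A* =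
  FixedVertex.supp-weight-bound G w w-pos A A* A-independent no-improvement nA n2A nA-max n2A-max
    (ConstantBounds.constants⇒bounds constants) u u∈A*
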